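{- For any $m$-colored composition $\alpha$ of $n$, the antipode $S_m$ of $\mathcal{Q}sym^{(m)}$ satisfies \[ S_m(F^{(m)}_\alpha) = (-1)^n F^{(m)}_{\widetilde{\alpha}},\] where $\widetilde{\alpha}$ is the conjugate of $\alpha$.
   Context: Fix $m\ge1$, $\omega$ a primitive $m$th root of unity. An $m$-colored composition of $n$ is $\alpha=(\omega^{j_1}\alpha_1,\ldots,\omega^{j_k}\alpha_k)$ with positive integers $\alpha_i$ summing to $n$ and colors $j_i\in\{0,\ldots,m-1\}$. Refinement order is generated by $(\ldots,\omega^j(\alpha_i+\alpha_{i+1}),\ldots)<(\ldots,\omega^j\alpha_i,\omega^j\alpha_{i+1},\ldots)$. $M^{(m)}_\alpha=\sum x_{i_1,j_1}^{\alpha_1}\cdots x_{i_k,j_k}^{\alpha_k}$ over $(i_1,j_1)<\cdots<(i_k,j_k)$ lexicographically; $F^{(m)}_\alpha=\sum_{\beta\ge\alpha}M^{(m)}_\beta$. $\mathcal{Q}sym^{(m)}$ is the span of all $M^{(m)}_\alpha$, a graded connected Hopf algebra with the usual product, counit the constant term, coproduct $\Delta_m(M^{(m)}_\alpha)=\sum_{\beta\gamma=\alpha}M^{(m)}_\beta\otimes M^{(m)}_\gamma$. Cycloribbon diagram of $\alpha$: unit squares in the plane (rows horizontal, $y$-axis pointing up). For each $i$ make a horizontal row of $\alpha_i$ squares each filled with the color $j_i$; place these successively: if $j_i<j_{i+1}$, the squares of part $i+1$ continue the same horizontal row immediately to the right of the last square of part $i$; if $j_i\ge j_{i+1}$, the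 first square of part $i+1$ is placed directly below the last square of part $i$. In the resulting diagram colors weakly increase left to right along rows and weakly decrease top to bottom along columns, and the composition is recovered by reading, from top-left to bottom-right, the maximal horizontal segments of constant color within each row as parts (length = number of squares, color = the fill). The conjugate $\widetilde{\alpha}$ is the colored composition recovered in this way from the diagram obtained by reflecting the cycloribbon diagram of $\alpha$ across the line $y=x$ (so rows and columns are switched), which is again such a diagram. For example, for $m=3$, $\alpha=(1,\omega^21,\omega2,\omega3,\omega^21,\omega^22,4)$ has $\widetilde\alpha=(1,1,1,1,\omega^21,\omega^22,\omega1,\omega1,\omega2,\omega1,\omega^21,1)$. -}

module Defs where

open import Data.Nat using (ℕ; zero; suc; _+_; _<ᵇ_)
open import Data.Fin using (Fin; toℕ)
import Data.Fin.Properties as FinP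
import Data.Nat.Properties as NatP
open import Data.Integer using (ℤ; 0ℤ; 1ℤ; _*_; -_; _^_) renaming (_+_ to _+ℤ_)
open import Data.Product using (_×_; _,_; proj₁; proj₂)
import Data.Product.Properties as ProdP
open import Data.List using (List; []; _∷_; _++_; map; concatMap; replicate; reverse; foldr)
import Data.List.Properties as ListP
open import Data.Bool using (Bool; true; false; if_then_else_)
open import Relation.Binary.PropositionalEquality using (_≡_)
open import Relation.Nullary using (yes; no; does)
open import Relation.Binary.Definitions using (DecidableEquality)

-- m-colored compositions.
-- A part  (k , j)  encodes the colored part  ω^j (k+1)  (size = suc k,
-- so every part is a positive integer), colour j ∈ {0,…,m-1}.

Part : ℕ → Set
Part m = ℕ × Fin m

Comp : ℕ → Set
Comp m = List (Part m)

partSize : ∀ {m} → Part m → ℕ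
partSize (k , _) = suc k

size : ∀ {m} → Comp m → ℕ
size α = foldr (λ p s → partSize p + s) 0 α

_≟P_ : ∀ {m} → DecidableEquality (Part m)
_≟P_ = ProdP.≡-dec NatP._≟_ FinP._≟_

_≟C_ : ∀ {m} → DecidableEquality (Comp m)
_≟C_ = ListP.≡-dec _≟P_

-- Qsym^(m) as the free ℤ-module on the basis  M^(m)_α  (α ∈ Comp m).

Lin : ℕ → Set
Lin m = List (ℤ × Comp m)

coeff : ∀ {m} → Lin m → Comp m → ℤ
coeff [] γ = 0ℤ
coeff ((c , β) ∷ x) γ with β ≟C γ
... | yes _ = c +ℤ coeff x γ
... | no _  = coeff x γ

infix 4 _≈_
_≈_ : ∀ {m} → Lin m → Lin m → Set
x ≈ y = ∀ γ → coeff x γ ≡ coeff y γ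

zeroL : ∀ {m} → Lin m
zeroL = []

M : ∀ {m} → Comp m → Lin m
M α = (1ℤ , α) ∷ []

scale : ∀ {m} → ℤ → Lin m → Lin m
scale c = map (λ { (d , β) → (c * d , β) })

sumL : ∀ {m} → List (Lin m) → Lin m
sumL = foldr _++_ []

-- M_α M_β = Σ_γ M_γ over the quasi-shuffles γ of α and β in
-- which only two parts of the SAME colour may be merged (they then come
-- from the same variable x_{i,j}); this is the product of the power
-- series M^(m)_α, M^(m)_β in the variables x_{i,j} ordered lexicographically.

qsh : ∀ {m} → Comp m → Comp m → List (Comp m)
qsh [] v = v ∷ []
qsh (a ∷ u) [] = (a ∷ u) ∷ []
qsh ((k , j) ∷ u) ((k' , j') ∷ v) =
  map ((k , j) ∷_) (qsh u ((k' , j') ∷ v))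
  ++ map ((k' , j') ∷_) (qsh ((k , j) ∷ u) v)
  ++ (if does (j FinP.≟ j') then map ((suc (k + k') , j) ∷_) (qsh u v) else [])

mul : ∀ {m} → Lin m → Lin m → Lin m
mul x y = concatMap (λ { (c , α) →
            concatMap (λ { (d , β) → map (λ γ → (c * d , γ)) (qsh α β) }) y }) x

deconc : ∀ {m} → Comp m → List (Comp m × Comp m)
deconc [] = ([] , []) ∷ []
deconc (a ∷ α) = ([] , a ∷ α) ∷ map (λ { (β , γ) → (a ∷ β , γ) }) (deconc α)

ηε : ∀ {m} → Comp m → Lin m
ηε [] = M []
ηε (_ ∷ _) = zeroL

-- A linear map Qsym^(m) → Qsym^(m) is given by its values on the basis M_α.
linExt : ∀ {m} → (Comp m → Lin m) → Lin m → Lin m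
linExt S x = concatMap (λ { (c , α) → scale c (S α) }) x

IsAntipode : ∀ {m} → (Comp m → Lin m) → Set
IsAntipode {m} S =
  (∀ (α : Comp m) →
     sumL (map (λ { (β , γ) → mul (S β) (M γ) }) (deconc α)) ≈ ηε α)
  × (∀ (α : Comp m) →
     sumL (map (λ { (β , γ) → mul (M β) (S γ) }) (deconc α)) ≈ ηε α)

-- Fundamental basis  F_α = Σ_{β ≥ α} M_β .
-- β ≥ α in the refinement order iff β is obtained by splitting every
-- part ω^j a of α into a composition of a, all of whose parts carry
-- colour j.

-- compositions of (suc k), in the pred-encoding of parts
compsP : ℕ → List (List ℕ)
compsP zero = (0 ∷ []) ∷ []
compsP (suc k) = map (0 ∷_) (compsP k) ++ map incHead (compsP k)
  where
  incHead : List ℕ → List ℕ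
  incHead [] = []
  incHead (x ∷ xs) = suc x ∷ xs

refinements : ∀ {m} → Comp m → List (Comp m)
refinements [] = [] ∷ []
refinements ((k , j) ∷ α) =
  concatMap (λ c → map (λ β → map (λ i → (i , j)) c ++ β) (refinements α))
            (compsP k)

F : ∀ {m} → Comp m → Lin m
F α = sumL (map M (refinements α))

-- The diagram is recorded as its sequence of cells from top-left to
-- bottom-right (their colours) together with the step from each cell to
-- the next: right (R) or down (D).

data Step : Set where
  R D : Step

cellsOf : ∀ {m} → Comp m → List (Fin m)
cellsOf = concatMap (λ { (k , j) → replicate (suc k) j })

stepsOf : ∀ {m} → Comp m → List Step
stepsOf [] = []
stepsOf ((k , j) ∷ []) = replicate k R
stepsOf ((k , j) ∷ (k' , j') ∷ α) =
  replicate k R ++ ((if toℕ j <ᵇ toℕ j' then R else D) ∷ stepsOf ((k' , j') ∷ α))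

-- read a diagram: parts = maximal horizontal runs of constant colour
readGo : ∀ {m} → Fin m → ℕ → List (Fin m) → List Step → Comp m
readGo cur k [] _ = (k , cur) ∷ []
readGo cur k (c ∷ cs) (R ∷ ss) with does (c FinP.≟ cur)
... | true  = readGo cur (suc k) cs ss
... | false = (k , cur) ∷ readGo c 0 cs ss
readGo cur k (c ∷ cs) (D ∷ ss) = (k , cur) ∷ readGo c 0 cs ss
readGo cur k (c ∷ cs) [] = (k , cur) ∷ readGo c 0 cs []

readDiagram : ∀ {m} → List (Fin m) → List Step → Comp m
readDiagram [] _ = []
readDiagram (c ∷ cs) ss = readGo c 0 cs ss

swapStep : Step → Step
swapStep R = D
swapStep D = R

-- Reflection across y = x sends right-steps to up-steps and down-steps to
-- left-steps; read from top-left to bottom-right the reflected diagram is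
-- the original cell sequence reversed, with R and D exchanged.
conj : ∀ {m} → Comp m → Comp m
conj α = readDiagram (reverse (cellsOf α)) (reverse (map swapStep (stepsOf α)))

sign : ℕ → ℤ
sign n = (- 1ℤ) ^ n

module Submission where

-- Hoffman's argument: the left antipode equations Σ_{βγ=α} S(M_β) M_γ = ε(M_α) determine S(M_α) by
-- induction on the length of α, and a telescoping sum shows that they are solved by
-- S(M_α) = (-1)^ℓ(α) Σ M_β over the coarsenings β of the reversed composition that merge only parts
-- of equal colour. Through F_α = Σ_{β ≥ α} M_β, both S(F_α) and (-1)^n F_α̃ then change in the same
-- way when a cell of colour j is added at the end of α: enlarging the last part prepends a part ω^j 1
-- and negates, while a new last part ω^j 1 also adds the term where it is merged into the first part.
-- On the conjugate side this is because the new cell becomes the first cell of the reflected diagram: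
-- a new first part ω^j 1, unless it just widens a first part of colour j.

open import Defs
open import Data.Nat as ℕ using (ℕ; _≤_; zero; suc; z≤n; s≤s; _<ᵇ_)
import Data.Nat.Properties as ℕP
open import Data.Integer using (ℤ; 0ℤ; 1ℤ; -_; _+_; _*_)
import Data.Integer.Properties as ℤP
open import Data.Integer.Tactic.RingSolver using (solve-∀)
open import Data.Fin using (Fin; toℕ)
import Data.Fin.Properties as FinP
open import Data.Product using (∃; ∃₂; _×_; _,_; proj₁; proj₂)
open import Data.List using (List; []; _∷_; _++_; map; concatMap; replicate; reverse; length)
import Data.List.Properties as LP
open import Data.List.Relation.Unary.All as All using (All; []; _∷_)
open import Data.List.Reverse using (Reverse; []; _∶_∶ʳ_; reverseView)
import Data.List.Relation.Unary.All.Properties as AllP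
open import Data.Bool using (Bool; true; false; if_then_else_)
open import Data.Empty using (⊥)
open import Data.Unit using (⊤; tt)
open import Level using (0ℓ)
open import Relation.Binary.PropositionalEquality
open import Relation.Binary.Bundles using (Setoid)
import Relation.Binary.Reasoning.Setoid as SetoidReasoning
open import Relation.Nullary using (yes; no; does; ¬_; contradiction)
open import Relation.Nullary.Decidable using (dec-true; dec-false)

NonEmpty : ∀ {A : Set} → List A → Set
NonEmpty [] = ⊥
NonEmpty (_ ∷ _) = ⊤

NonEmpty-++ʳ : ∀ {A : Set} (xs : List A) {ys} → NonEmpty ys → NonEmpty (xs ++ ys)
NonEmpty-++ʳ [] ne = ne
NonEmpty-++ʳ (_ ∷ _) _ = tt

module _ {m : ℕ} where
  private
    L = Lin m
    W = Comp m

  -- Linear combinations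

  eval : (W → ℤ) → L → ℤ
  eval g [] = 0ℤ
  eval g ((c , α) ∷ x) = c * g α + eval g x

  indicator : W → W → ℤ
  indicator γ α = if does (α ≟C γ) then 1ℤ else 0ℤ

  coeff≡eval-indicator : ∀ x γ → coeff x γ ≡ eval (indicator γ) x
  coeff≡eval-indicator [] γ = refl
  coeff≡eval-indicator ((c , β) ∷ x) γ with β ≟C γ
  ... | yes _ = cong₂ _+_ (sym (ℤP.*-identityʳ c)) (coeff≡eval-indicator x γ)
  ... | no _ = begin
      coeff x γ                           ≡⟨ coeff≡eval-indicator x γ ⟩
      eval (indicator γ) x                ≡⟨ ℤP.+-identityˡ _ ⟨
      0ℤ + eval (indicator γ) x           ≡⟨ cong (_+ eval (indicator γ) x) (ℤP.*-zeroʳ c) ⟨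
      c * 0ℤ + eval (indicator γ) x       ∎
    where open ≡-Reasoning

  eval-++ : ∀ g x y → eval g (x ++ y) ≡ eval g x + eval g y
  eval-++ g [] y = sym (ℤP.+-identityˡ _)
  eval-++ g ((c , α) ∷ x) y =
    trans (cong (c * g α +_) (eval-++ g x y)) (sym (ℤP.+-assoc (c * g α) (eval g x) (eval g y)))

  eval-scale : ∀ g d x → eval g (scale d x) ≡ d * eval g x
  eval-scale g d [] = sym (ℤP.*-zeroʳ d)
  eval-scale g d ((c , α) ∷ x) =
    trans (cong (d * c * g α +_) (eval-scale g d x)) (distrib d c (g α) (eval g x))
    where
    distrib : ∀ a b e f → a * b * e + a * f ≡ a * (b * e + f)
    distrib = solve-∀

  eval-cong : ∀ {g h : W → ℤ} → (∀ α → g α ≡ h α) → ∀ x → eval g x ≡ eval h x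
  eval-cong e [] = refl
  eval-cong e ((c , α) ∷ x) = cong₂ (λ a b → c * a + b) (e α) (eval-cong e x)

  coeff-++ : ∀ x y γ → coeff (x ++ y) γ ≡ coeff x γ + coeff y γ
  coeff-++ x y γ = begin
    coeff (x ++ y) γ                                     ≡⟨ coeff≡eval-indicator (x ++ y) γ ⟩
    eval (indicator γ) (x ++ y)                          ≡⟨ eval-++ (indicator γ) x y ⟩
    eval (indicator γ) x + eval (indicator γ) y
      ≡⟨ cong₂ _+_ (coeff≡eval-indicator x γ) (coeff≡eval-indicator y γ) ⟨
    coeff x γ + coeff y γ                                ∎
    where open ≡-Reasoning

  coeff-scale : ∀ d x γ → coeff (scale d x) γ ≡ d * coeff x γ
  coeff-scale d x γ = begin
    coeff (scale d x) γ                 ≡⟨ coeff≡eval-indicator (scale d x) γ ⟩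
    eval (indicator γ) (scale d x)      ≡⟨ eval-scale (indicator γ) d x ⟩
    d * eval (indicator γ) x            ≡⟨ cong (d *_) (coeff≡eval-indicator x γ) ⟨
    d * coeff x γ                       ∎
    where open ≡-Reasoning

  coeff-cons : ∀ c (β : W) x γ →
    coeff ((c , β) ∷ x) γ ≡ (if does (β ≟C γ) then c + coeff x γ else coeff x γ)
  coeff-cons c β x γ with β ≟C γ
  ... | yes _ = refl
  ... | no _ = refl

  deleteWord : W → L → L
  deleteWord β [] = []
  deleteWord β ((c , α) ∷ x) with α ≟C β
  ... | yes _ = deleteWord β x
  ... | no _ = (c , α) ∷ deleteWord β x

  length-deleteWord : ∀ β x → length (deleteWord β x) ≤ length x
  length-deleteWord β [] = z≤n
  length-deleteWord β ((c , α) ∷ x) with α ≟C β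
  ... | yes _ = ℕP.m≤n⇒m≤1+n (length-deleteWord β x)
  ... | no _ = s≤s (length-deleteWord β x)

  eval-deleteWord : ∀ g β x → eval g x ≡ coeff x β * g β + eval g (deleteWord β x)
  eval-deleteWord g β [] = sym (ℤP.*-zeroˡ (g β))
  eval-deleteWord g β ((c , α) ∷ x) with α ≟C β
  ... | yes refl = trans (cong (c * g α +_) (eval-deleteWord g α x)) (regroup c (g α) (coeff x α) _)
    where
    regroup : ∀ a b e f → a * b + (e * b + f) ≡ (a + e) * b + f
    regroup = solve-∀
  ... | no _ = trans (cong (c * g α +_) (eval-deleteWord g β x)) (swap (c * g α) (coeff x β * g β) (eval g (deleteWord β x)))
    where
    swap : ∀ a b f → a + (b + f) ≡ b + (a + f)
    swap = solve-∀

  coeff-cons-≢ : ∀ c {β γ : W} x → ¬ β ≡ γ → coeff ((c , β) ∷ x) γ ≡ coeff x γ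
  coeff-cons-≢ c {β} {γ} x β≢γ with β ≟C γ
  ... | yes β≡γ = contradiction β≡γ β≢γ
  ... | no _ = refl

  coeff-deleteWord-self : ∀ β x → coeff (deleteWord β x) β ≡ 0ℤ
  coeff-deleteWord-self β [] = refl
  coeff-deleteWord-self β ((c , α) ∷ x) with α ≟C β
  ... | yes _ = coeff-deleteWord-self β x
  ... | no α≢β = trans (coeff-cons-≢ c _ α≢β) (coeff-deleteWord-self β x)

  coeff-deleteWord-other : ∀ {β γ} x → ¬ β ≡ γ → coeff (deleteWord β x) γ ≡ coeff x γ
  coeff-deleteWord-other [] _ = refl
  coeff-deleteWord-other {β} {γ} ((c , α) ∷ x) β≢γ with α ≟C β
  ... | yes refl = trans (coeff-deleteWord-other x β≢γ) (sym (coeff-cons-≢ c x β≢γ))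
  ... | no _ = trans (coeff-cons c α _ γ) (trans (cong (λ e → if does (α ≟C γ) then c + e else e)
                 (coeff-deleteWord-other x β≢γ)) (sym (coeff-cons c α x γ)))

  -- Induction on the length bound n: deleting every occurrence of the first word shortens x.
  eval-vanishes : ∀ g n x → length x ≤ n → (∀ γ → coeff x γ ≡ 0ℤ) → eval g x ≡ 0ℤ
  eval-vanishes g n [] _ _ = refl
  eval-vanishes g (suc n) ((c , β) ∷ x) (s≤s |x|≤n) x≈0 = begin
    c * g β + eval g x                                 ≡⟨ cong (c * g β +_) (eval-deleteWord g β x) ⟩
    c * g β + (coeff x β * g β + eval g x∖β)           ≡⟨ regroup c (coeff x β) (g β) _ ⟩
    (c + coeff x β) * g β + eval g x∖β                 ≡⟨ cong₂ (λ a b → a * g β + b) coeffβ≡0 rest≡0 ⟩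
    0ℤ * g β + 0ℤ                                      ≡⟨ cong (_+ 0ℤ) (ℤP.*-zeroˡ (g β)) ⟩
    0ℤ                                                 ∎
    where
    open ≡-Reasoning
    x∖β = deleteWord β x
    regroup : ∀ a b e f → a * e + (b * e + f) ≡ (a + b) * e + f
    regroup = solve-∀
    coeffβ≡0 : c + coeff x β ≡ 0ℤ
    coeffβ≡0 = trans (sym (trans (coeff-cons c β x β)
                 (cong (λ b → if b then c + coeff x β else coeff x β) (dec-true (β ≟C β) refl)))) (x≈0 β)
    rest-coeff : ∀ γ → coeff x∖β γ ≡ 0ℤ
    rest-coeff γ with β ≟C γ
    ... | yes refl = coeff-deleteWord-self β x
    ... | no β≢γ = begin
      coeff x∖β γ                  ≡⟨ coeff-deleteWord-other x β≢γ ⟩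
      coeff x γ                    ≡⟨ coeff-cons-≢ c x β≢γ ⟨
      coeff ((c , β) ∷ x) γ        ≡⟨ x≈0 γ ⟩
      0ℤ                           ∎
    rest≡0 : eval g x∖β ≡ 0ℤ
    rest≡0 = eval-vanishes g n x∖β (ℕP.≤-trans (length-deleteWord β x) |x|≤n) rest-coeff

  eval-resp-≈ : ∀ g {x y} → x ≈ y → eval g x ≡ eval g y
  eval-resp-≈ g {x} {y} x≈y = ℤP.i-j≡0⇒i≡j (eval g x) (eval g y) (begin
    eval g x + - eval g y                      ≡⟨ cong (eval g x +_) (ℤP.-1*i≡-i (eval g y)) ⟨
    eval g x + - 1ℤ * eval g y                 ≡⟨ cong (eval g x +_) (eval-scale g (- 1ℤ) y) ⟨
    eval g x + eval g (scale (- 1ℤ) y)         ≡⟨ eval-++ g x (scale (- 1ℤ) y) ⟨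
    eval g (x ++ scale (- 1ℤ) y)               ≡⟨ eval-vanishes g _ (x ++ scale (- 1ℤ) y) ℕP.≤-refl difference≈0 ⟩
    0ℤ                                         ∎)
    where
    open ≡-Reasoning
    difference≈0 : ∀ γ → coeff (x ++ scale (- 1ℤ) y) γ ≡ 0ℤ
    difference≈0 γ = begin
      coeff (x ++ scale (- 1ℤ) y) γ            ≡⟨ coeff-++ x _ γ ⟩
      coeff x γ + coeff (scale (- 1ℤ) y) γ     ≡⟨ cong₂ _+_ (x≈y γ) (coeff-scale (- 1ℤ) y γ) ⟩
      coeff y γ + - 1ℤ * coeff y γ             ≡⟨ cong (coeff y γ +_) (ℤP.-1*i≡-i (coeff y γ)) ⟩
      coeff y γ + - coeff y γ                  ≡⟨ ℤP.+-inverseʳ (coeff y γ) ⟩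
      0ℤ                                       ∎

  -- Wrapping _≈_ in a record makes x and y inferable from a proof of x ≋ y.
  record _≋_ (x y : L) : Set where
    constructor mk≋
    field get : x ≈ y
  open _≋_ public
  infix 4 _≋_

  ≋-refl : ∀ {x : L} → x ≋ x
  ≋-refl = mk≋ (λ γ → refl)

  ≋-sym : ∀ {x y : L} → x ≋ y → y ≋ x
  ≋-sym e = mk≋ (λ γ → sym (get e γ))

  ≋-trans : ∀ {x y z : L} → x ≋ y → y ≋ z → x ≋ z
  ≋-trans e f = mk≋ (λ γ → trans (get e γ) (get f γ))

  ≡⇒≋ : ∀ {x y : L} → x ≡ y → x ≋ y
  ≡⇒≋ refl = ≋-refl

  ≋-setoid : Setoid 0ℓ 0ℓ
  ≋-setoid = record
    { Carrier = L ; _≈_ = _≋_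
    ; isEquivalence = record { refl = ≋-refl ; sym = ≋-sym ; trans = ≋-trans } }

  ++-cong : ∀ {x x' y y' : L} → x ≋ x' → y ≋ y' → x ++ y ≋ x' ++ y'
  ++-cong {x} {x'} {y} {y'} e f = mk≋ λ γ →
    trans (coeff-++ x y γ) (trans (cong₂ _+_ (get e γ) (get f γ)) (sym (coeff-++ x' y' γ)))

  ++-identityʳ : ∀ (x : L) → x ++ [] ≋ x
  ++-identityʳ x = ≡⇒≋ (LP.++-identityʳ x)

  ++-interchange : ∀ (a b c d : L) → (a ++ b) ++ (c ++ d) ≋ (a ++ c) ++ (b ++ d)
  ++-interchange a b c d = mk≋ λ γ → begin
    coeff ((a ++ b) ++ (c ++ d)) γ
      ≡⟨ trans (coeff-++ (a ++ b) (c ++ d) γ) (cong₂ _+_ (coeff-++ a b γ) (coeff-++ c d γ)) ⟩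
    (coeff a γ + coeff b γ) + (coeff c γ + coeff d γ)
      ≡⟨ middle-four (coeff a γ) (coeff b γ) (coeff c γ) (coeff d γ) ⟩
    (coeff a γ + coeff c γ) + (coeff b γ + coeff d γ)
      ≡⟨ trans (coeff-++ (a ++ c) (b ++ d) γ) (cong₂ _+_ (coeff-++ a c γ) (coeff-++ b d γ)) ⟨
    coeff ((a ++ c) ++ (b ++ d)) γ ∎
    where
    open ≡-Reasoning
    middle-four : ∀ a b c d → (a + b) + (c + d) ≡ (a + c) + (b + d)
    middle-four = solve-∀

  scale-cong : ∀ d {x y : L} → x ≋ y → scale d x ≋ scale d y
  scale-cong d {x} {y} e = mk≋ λ γ →
    trans (coeff-scale d x γ) (trans (cong (d *_) (get e γ)) (sym (coeff-scale d y γ)))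

  scale-++ : ∀ d (x y : L) → scale d (x ++ y) ≡ scale d x ++ scale d y
  scale-++ d x y = LP.map-++ _ x y

  scale-scale : ∀ d e (x : L) → scale d (scale e x) ≋ scale (d * e) x
  scale-scale d e x = mk≋ λ γ → begin
    coeff (scale d (scale e x)) γ     ≡⟨ coeff-scale d (scale e x) γ ⟩
    d * coeff (scale e x) γ           ≡⟨ cong (d *_) (coeff-scale e x γ) ⟩
    d * (e * coeff x γ)               ≡⟨ ℤP.*-assoc d e (coeff x γ) ⟨
    d * e * coeff x γ                 ≡⟨ coeff-scale (d * e) x γ ⟨
    coeff (scale (d * e) x) γ         ∎
    where open ≡-Reasoning

  scale-identity : ∀ (x : L) → scale 1ℤ x ≋ x
  scale-identity x = mk≋ λ γ → trans (coeff-scale 1ℤ x γ) (ℤP.*-identityˡ _)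

  neg : L → L
  neg = scale (- 1ℤ)

  neg-coeff : ∀ x γ → coeff (neg x) γ ≡ - coeff x γ
  neg-coeff x γ = trans (coeff-scale (- 1ℤ) x γ) (ℤP.-1*i≡-i (coeff x γ))

  ++-inverseʳ : ∀ (x : L) → x ++ neg x ≋ []
  ++-inverseʳ x = mk≋ λ γ →
    trans (coeff-++ x (neg x) γ) (trans (cong (coeff x γ +_) (neg-coeff x γ)) (ℤP.+-inverseʳ (coeff x γ)))

  difference≋[]⇒≋ : ∀ (x y : L) → x ++ neg y ≋ [] → x ≋ y
  difference≋[]⇒≋ x y e = mk≋ λ γ → ℤP.i-j≡0⇒i≡j (coeff x γ) (coeff y γ)
    (trans (cong (coeff x γ +_) (sym (neg-coeff y γ))) (trans (sym (coeff-++ x (neg y) γ)) (get e γ)))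

  neg-++-cancelʳ : ∀ (x y : L) → neg (x ++ y) ++ y ≋ neg x
  neg-++-cancelʳ x y = mk≋ λ γ → begin
    coeff (neg (x ++ y) ++ y) γ          ≡⟨ coeff-++ (neg (x ++ y)) y γ ⟩
    coeff (neg (x ++ y)) γ + coeff y γ
      ≡⟨ cong (_+ coeff y γ) (trans (neg-coeff (x ++ y) γ) (cong -_ (coeff-++ x y γ))) ⟩
    - (coeff x γ + coeff y γ) + coeff y γ ≡⟨ cancel (coeff x γ) (coeff y γ) ⟩
    - coeff x γ                          ≡⟨ neg-coeff x γ ⟨
    coeff (neg x) γ                      ∎
    where
    open ≡-Reasoning
    cancel : ∀ a b → - (a + b) + b ≡ - a
    cancel = solve-∀

  scale-++-cancelʳ : ∀ s (x y : L) → scale s (x ++ y) ++ scale (- 1ℤ * s) y ≋ scale s x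
  scale-++-cancelʳ s x y = mk≋ λ γ → begin
    coeff (scale s (x ++ y) ++ scale (- 1ℤ * s) y) γ
      ≡⟨ coeff-++ (scale s (x ++ y)) _ γ ⟩
    coeff (scale s (x ++ y)) γ + coeff (scale (- 1ℤ * s) y) γ
      ≡⟨ cong₂ _+_ (trans (coeff-scale s (x ++ y) γ) (cong (s *_) (coeff-++ x y γ))) (coeff-scale (- 1ℤ * s) y γ) ⟩
    s * (coeff x γ + coeff y γ) + (- 1ℤ * s) * coeff y γ
      ≡⟨ cancel s (coeff x γ) (coeff y γ) ⟩
    s * coeff x γ
      ≡⟨ coeff-scale s x γ ⟨
    coeff (scale s x) γ ∎
    where
    open ≡-Reasoning
    cancel : ∀ s a b → s * (a + b) + (- 1ℤ * s) * b ≡ s * a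
    cancel = solve-∀

  eval-linExt : ∀ g (f : W → L) x → eval g (linExt f x) ≡ eval (λ α → eval g (f α)) x
  eval-linExt g f [] = refl
  eval-linExt g f ((c , α) ∷ x) =
    trans (eval-++ g (scale c (f α)) (linExt f x)) (cong₂ _+_ (eval-scale g c (f α)) (eval-linExt g f x))

  coeff-linExt : ∀ (f : W → L) x γ → coeff (linExt f x) γ ≡ eval (λ α → coeff (f α) γ) x
  coeff-linExt f x γ = begin
    coeff (linExt f x) γ                           ≡⟨ coeff≡eval-indicator (linExt f x) γ ⟩
    eval (indicator γ) (linExt f x)                ≡⟨ eval-linExt (indicator γ) f x ⟩
    eval (λ α → eval (indicator γ) (f α)) x        ≡⟨ eval-cong (λ α → coeff≡eval-indicator (f α) γ) x ⟨
    eval (λ α → coeff (f α) γ) x                   ∎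
    where open ≡-Reasoning

  linExt-cong : ∀ (f : W → L) {x y} → x ≋ y → linExt f x ≋ linExt f y
  linExt-cong f {x} {y} e = mk≋ λ γ →
    trans (coeff-linExt f x γ) (trans (eval-resp-≈ (λ α → coeff (f α) γ) {x} {y} (get e)) (sym (coeff-linExt f y γ)))

  AllWords : (W → Set) → L → Set
  AllWords P = All (λ p → P (proj₂ p))

  AllWords-scale : ∀ {P} c {x} → AllWords P x → AllWords P (scale c x)
  AllWords-scale c = AllP.map⁺

  AllWords-linExt : ∀ {P} (f : W → L) {x} → (∀ t → AllWords P (f t)) → AllWords P (linExt f x)
  AllWords-linExt f {[]} h = []
  AllWords-linExt f {(c , α) ∷ x} h = AllP.++⁺ (AllWords-scale c (h α)) (AllWords-linExt f {x} h)

  linExt-ext-on : ∀ {f g : W → L} x → AllWords (λ α → f α ≋ g α) x → linExt f x ≋ linExt g x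
  linExt-ext-on {f} {g} x es = mk≋ λ γ →
    trans (coeff-linExt f x γ) (trans (eval-cong-on x es γ) (sym (coeff-linExt g x γ)))
    where
    eval-cong-on : ∀ x → AllWords (λ α → f α ≋ g α) x → ∀ γ →
                   eval (λ α → coeff (f α) γ) x ≡ eval (λ α → coeff (g α) γ) x
    eval-cong-on [] [] γ = refl
    eval-cong-on ((c , α) ∷ x) (e ∷ es) γ = cong₂ (λ a b → c * a + b) (get e γ) (eval-cong-on x es γ)

  linExt-ext : ∀ {f g : W → L} x → (∀ α → f α ≋ g α) → linExt f x ≋ linExt g x
  linExt-ext x e = linExt-ext-on x (All.universal (λ p → e (proj₂ p)) x)

  linExt-++ : ∀ (f : W → L) x y → linExt f (x ++ y) ≡ linExt f x ++ linExt f y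
  linExt-++ f = LP.concatMap-++ _

  eval-M : ∀ g w → eval g (M w) ≡ g w
  eval-M g w = trans (ℤP.+-identityʳ _) (ℤP.*-identityˡ _)

  linExt-M : ∀ (f : W → L) w → linExt f (M w) ≋ f w
  linExt-M f w = mk≋ λ γ → trans (coeff-linExt f (M w) γ) (eval-M (λ α → coeff (f α) γ) w)

  linExt-identity : ∀ x → linExt M x ≋ x
  linExt-identity x = mk≋ λ γ → begin
    coeff (linExt M x) γ                 ≡⟨ coeff-linExt M x γ ⟩
    eval (λ α → coeff (M α) γ) x
      ≡⟨ eval-cong (λ α → trans (coeff≡eval-indicator (M α) γ) (eval-M (indicator γ) α)) x ⟩
    eval (indicator γ) x                 ≡⟨ coeff≡eval-indicator x γ ⟨
    coeff x γ                            ∎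
    where open ≡-Reasoning

  linExt-∘ : ∀ (f g : W → L) x → linExt f (linExt g x) ≋ linExt (λ α → linExt f (g α)) x
  linExt-∘ f g x = mk≋ λ γ → begin
    coeff (linExt f (linExt g x)) γ                   ≡⟨ coeff-linExt f (linExt g x) γ ⟩
    eval (λ α → coeff (f α) γ) (linExt g x)           ≡⟨ eval-linExt (λ α → coeff (f α) γ) g x ⟩
    eval (λ α → eval (λ β → coeff (f β) γ) (g α)) x   ≡⟨ eval-cong (λ α → coeff-linExt f (g α) γ) x ⟨
    eval (λ α → coeff (linExt f (g α)) γ) x           ≡⟨ coeff-linExt (λ α → linExt f (g α)) x γ ⟨
    coeff (linExt (λ α → linExt f (g α)) x) γ         ∎
    where open ≡-Reasoning

  linExt-++ᶠ : ∀ (f g : W → L) x → linExt (λ α → f α ++ g α) x ≋ linExt f x ++ linExt g x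
  linExt-++ᶠ f g [] = ≋-refl
  linExt-++ᶠ f g ((c , α) ∷ x) = begin
    scale c (f α ++ g α) ++ linExt (λ α → f α ++ g α) x
      ≈⟨ ++-cong (≡⇒≋ (scale-++ c (f α) (g α))) (linExt-++ᶠ f g x) ⟩
    (scale c (f α) ++ scale c (g α)) ++ (linExt f x ++ linExt g x)
      ≈⟨ ++-interchange (scale c (f α)) _ _ _ ⟩
    (scale c (f α) ++ linExt f x) ++ (scale c (g α) ++ linExt g x) ∎
    where open SetoidReasoning ≋-setoid

  linExt-scale : ∀ d (f : W → L) x → linExt f (scale d x) ≋ scale d (linExt f x)
  linExt-scale d f x = mk≋ λ γ → begin
    coeff (linExt f (scale d x)) γ           ≡⟨ coeff-linExt f (scale d x) γ ⟩
    eval (λ α → coeff (f α) γ) (scale d x)   ≡⟨ eval-scale (λ α → coeff (f α) γ) d x ⟩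
    d * eval (λ α → coeff (f α) γ) x         ≡⟨ cong (d *_) (coeff-linExt f x γ) ⟨
    d * coeff (linExt f x) γ                 ≡⟨ coeff-scale d (linExt f x) γ ⟨
    coeff (scale d (linExt f x)) γ           ∎
    where open ≡-Reasoning

  linExt-scaleᶠ : ∀ d (f : W → L) x → linExt (λ α → scale d (f α)) x ≋ scale d (linExt f x)
  linExt-scaleᶠ d f [] = ≋-refl
  linExt-scaleᶠ d f ((c , α) ∷ x) = begin
    scale c (scale d (f α)) ++ linExt (λ α → scale d (f α)) x
      ≈⟨ ++-cong (scale-scale c d (f α)) (linExt-scaleᶠ d f x) ⟩
    scale (c * d) (f α) ++ scale d (linExt f x)
      ≈⟨ ++-cong (≋-trans (≡⇒≋ (cong (λ e → scale e (f α)) (ℤP.*-comm c d))) (≋-sym (scale-scale d c (f α))))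
                 ≋-refl ⟩
    scale d (scale c (f α)) ++ scale d (linExt f x)
      ≡⟨ scale-++ d (scale c (f α)) (linExt f x) ⟨
    scale d (scale c (f α) ++ linExt f x) ∎
    where open SetoidReasoning ≋-setoid

  linExt-zero : ∀ x → linExt (λ (_ : W) → []) x ≋ []
  linExt-zero [] = ≋-refl
  linExt-zero (_ ∷ x) = linExt-zero x

  lift : (W → W) → L → L
  lift h = linExt (λ t → M (h t))

  lift-cong : ∀ (h : W → W) {x y} → x ≋ y → lift h x ≋ lift h y
  lift-cong h = linExt-cong (λ t → M (h t))

  lift-M : ∀ (h : W → W) w → lift h (M w) ≋ M (h w)
  lift-M h = linExt-M (λ t → M (h t))

  lift-∘ : ∀ (f g : W → W) x → lift f (lift g x) ≋ lift (λ t → f (g t)) x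
  lift-∘ f g x = ≋-trans (linExt-∘ (λ t → M (f t)) (λ t → M (g t)) x) (linExt-ext x (λ t → lift-M f (g t)))

  lift-comm-on : ∀ {P : W → Set} (f g f' g' : W → W) x → AllWords P x →
                 (∀ t → P t → f (g t) ≡ g' (f' t)) → lift f (lift g x) ≋ lift g' (lift f' x)
  lift-comm-on f g f' g' x px comm = begin
    lift f (lift g x)                ≈⟨ lift-∘ f g x ⟩
    lift (λ t → f (g t)) x
      ≈⟨ linExt-ext-on x (All.map (λ {p} pt → ≡⇒≋ (cong M (comm (proj₂ p) pt))) px) ⟩
    lift (λ t → g' (f' t)) x         ≈⟨ lift-∘ g' f' x ⟨
    lift g' (lift f' x)              ∎
    where open SetoidReasoning ≋-setoid

  sumM : List W → L
  sumM ws = sumL (map M ws)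

  sumM-++ : ∀ xs ys → sumM (xs ++ ys) ≡ sumM xs ++ sumM ys
  sumM-++ xs ys = trans (cong sumL (LP.map-++ M xs ys)) (sym (LP.concat-++ (map M xs) (map M ys)))

  sumM-concatMap : ∀ {A : Set} (g : A → List W) (cs : List A) → sumM (concatMap g cs) ≡ sumL (map (λ c → sumM (g c)) cs)
  sumM-concatMap g [] = refl
  sumM-concatMap g (c ∷ cs) = trans (sumM-++ (g c) (concatMap g cs)) (cong (sumM (g c) ++_) (sumM-concatMap g cs))

  lift-sumM : ∀ (h : W → W) ws → lift h (sumM ws) ≋ sumM (map h ws)
  lift-sumM h [] = ≋-refl
  lift-sumM h (w ∷ ws) =
    ≋-trans (≡⇒≋ (linExt-++ (λ t → M (h t)) (M w) (sumM ws))) (++-cong (lift-M h w) (lift-sumM h ws))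

  AllWords-sumM : ∀ {P : W → Set} {ws} → All P ws → AllWords P (sumM ws)
  AllWords-sumM [] = []
  AllWords-sumM (p ∷ ps) = p ∷ AllWords-sumM ps

  linExt-sumL : ∀ (f : W → L) (xs : List L) → linExt f (sumL xs) ≡ sumL (map (linExt f) xs)
  linExt-sumL f [] = refl
  linExt-sumL f (x ∷ xs) = trans (linExt-++ f x (sumL xs)) (cong (linExt f x ++_) (linExt-sumL f xs))

  linExt-sumL-map : ∀ {A : Set} (f : W → L) (g : A → L) (cs : List A) →
                    linExt f (sumL (map g cs)) ≡ sumL (map (λ c → linExt f (g c)) cs)
  linExt-sumL-map f g cs = trans (linExt-sumL f (map g cs)) (cong sumL (sym (LP.map-∘ cs)))

  sumL-cong-on : ∀ {A : Set} {Q : A → Set} (g h : A → L) {cs : List A} → All Q cs →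
                 (∀ c → Q c → g c ≋ h c) → sumL (map g cs) ≋ sumL (map h cs)
  sumL-cong-on g h [] e = ≋-refl
  sumL-cong-on g h (q ∷ qs) e = ++-cong (e _ q) (sumL-cong-on g h qs e)

  sumL-cong : ∀ {A : Set} (g h : A → L) (cs : List A) → (∀ c → g c ≋ h c) → sumL (map g cs) ≋ sumL (map h cs)
  sumL-cong g h cs e = sumL-cong-on g h (All.universal (λ _ → tt) cs) (λ c _ → e c)

  sumL-++ᶠ : ∀ {A : Set} (g h : A → L) (cs : List A) →
             sumL (map (λ c → g c ++ h c) cs) ≋ sumL (map g cs) ++ sumL (map h cs)
  sumL-++ᶠ g h [] = ≋-refl
  sumL-++ᶠ g h (c ∷ cs) = ≋-trans (++-cong {g c ++ h c} ≋-refl (sumL-++ᶠ g h cs)) (++-interchange (g c) (h c) _ _)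

  -- Products with a basis element

  prepend : Part m → L → L
  prepend b = lift (b ∷_)

  append : Part m → L → L
  append c = lift (_++ c ∷ [])

  prependWord : W → L → L
  prependWord u = lift (u ++_)

  mergeOnto : Part m → W → L
  mergeOnto b [] = []
  mergeOnto (k , j) ((k' , j') ∷ t) = if does (j FinP.≟ j') then M ((suc (k ℕ.+ k') , j) ∷ t) else []

  mergeHead : Part m → L → L
  mergeHead b = linExt (mergeOnto b)

  mergeHead-cong : ∀ b {x y} → x ≋ y → mergeHead b x ≋ mergeHead b y
  mergeHead-cong b = linExt-cong (mergeOnto b)

  mergeOnto-same : ∀ (j : Fin m) k x r → mergeOnto (k , j) ((x , j) ∷ r) ≡ M ((suc (k ℕ.+ x) , j) ∷ r)
  mergeOnto-same j k x r rewrite dec-true (j FinP.≟ j) refl = refl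

  mergeOnto-other : ∀ {i j : Fin m} k x r → ¬ i ≡ j → mergeOnto (k , i) ((x , j) ∷ r) ≡ []
  mergeOnto-other {i} {j} k x r i≢j rewrite dec-false (i FinP.≟ j) i≢j = refl

  infixl 7 _·M_
  _·M_ : L → W → L
  x ·M v = linExt (λ t → sumM (qsh t v)) x

  mul-M : ∀ x v → mul x (M v) ≡ x ·M v
  mul-M [] v = refl
  mul-M ((c , α) ∷ x) v = cong₂ _++_ (scaled-sumM (qsh α v)) (mul-M x v)
    where
    scaled-sumM : ∀ ws → map (λ γ → (c * 1ℤ , γ)) ws ++ [] ≡ scale c (sumM ws)
    scaled-sumM [] = refl
    scaled-sumM (w ∷ ws) = cong ((c * 1ℤ , w) ∷_) (scaled-sumM ws)

  qsh-[]ʳ : ∀ (t : W) → qsh t [] ≡ t ∷ []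
  qsh-[]ʳ [] = refl
  qsh-[]ʳ (a ∷ t) = refl

  ·M-identityʳ : ∀ x → x ·M [] ≋ x
  ·M-identityʳ x = ≋-trans (linExt-ext x (λ t → ≡⇒≋ (cong sumM (qsh-[]ʳ t)))) (linExt-identity x)

  ·M-identityˡ : ∀ v → M [] ·M v ≋ M v
  ·M-identityˡ v = linExt-M (λ t → sumM (qsh t v)) []

  -- x ·M (b ∷ v) splits by the origin of the first part of each term: a part of x (leftLed), b itself,
  -- or b merged with the first part of a word of x (mergeLed); rightLed collects the last two kinds.

  leftLedʷ : W → W → L
  leftLedʷ w [] = []
  leftLedʷ w (a ∷ t) = sumM (map (a ∷_) (qsh t w))

  leftLed : L → W → L
  leftLed x w = linExt (leftLedʷ w) x

  mergeLedʷ : Part m → W → W → L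
  mergeLedʷ b v [] = []
  mergeLedʷ (k' , j') v ((k , j) ∷ t) =
    if does (j FinP.≟ j') then sumM (map ((suc (k ℕ.+ k') , j) ∷_) (qsh t v)) else []

  mergeLed : L → Part m → W → L
  mergeLed x b v = linExt (mergeLedʷ b v) x

  rightLed : L → Part m → W → L
  rightLed x b v = prepend b (x ·M v) ++ mergeLed x b v

  sumM-qsh-cons : ∀ b v (t : W) →
    sumM (qsh t (b ∷ v)) ≡ leftLedʷ (b ∷ v) t ++ (sumM (map (b ∷_) (qsh t v)) ++ mergeLedʷ b v t)
  sumM-qsh-cons b v [] = refl
  sumM-qsh-cons (k' , j') v ((k , j) ∷ t) =
    trans (sumM-++ (map ((k , j) ∷_) (qsh t ((k' , j') ∷ v))) _)
      (cong (sumM (map ((k , j) ∷_) (qsh t ((k' , j') ∷ v))) ++_)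
        (trans (sumM-++ (map ((k' , j') ∷_) (qsh ((k , j) ∷ t) v)) _)
          (cong (sumM (map ((k' , j') ∷_) (qsh ((k , j) ∷ t) v)) ++_) (sumM-if (does (j FinP.≟ j'))))))
    where
    sumM-if : ∀ (c : Bool) {ws} → sumM (if c then ws else []) ≡ (if c then sumM ws else [])
    sumM-if true = refl
    sumM-if false = refl

  ·M-cons : ∀ x b v → x ·M (b ∷ v) ≋ leftLed x (b ∷ v) ++ rightLed x b v
  ·M-cons x b v = begin
    x ·M (b ∷ v)
      ≈⟨ linExt-ext x (λ t → ≡⇒≋ (sumM-qsh-cons b v t)) ⟩
    linExt (λ t → leftLedʷ (b ∷ v) t ++ (sumM (map (b ∷_) (qsh t v)) ++ mergeLedʷ b v t)) x
      ≈⟨ linExt-++ᶠ (leftLedʷ (b ∷ v)) _ x ⟩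
    leftLed x (b ∷ v) ++ linExt (λ t → sumM (map (b ∷_) (qsh t v)) ++ mergeLedʷ b v t) x
      ≈⟨ ++-cong {leftLed x (b ∷ v)} ≋-refl (linExt-++ᶠ (λ t → sumM (map (b ∷_) (qsh t v))) (mergeLedʷ b v) x) ⟩
    leftLed x (b ∷ v) ++ (linExt (λ t → sumM (map (b ∷_) (qsh t v))) x ++ mergeLed x b v)
      ≈⟨ ++-cong {leftLed x (b ∷ v)} ≋-refl (++-cong {_} {_} {mergeLed x b v} b-first ≋-refl) ⟩
    leftLed x (b ∷ v) ++ rightLed x b v ∎
    where
    open SetoidReasoning ≋-setoid
    b-first : linExt (λ t → sumM (map (b ∷_) (qsh t v))) x ≋ prepend b (x ·M v)
    b-first = ≋-sym (≋-trans (linExt-∘ (λ t → M (b ∷ t)) (λ t → sumM (qsh t v)) x)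
                             (linExt-ext x (λ t → lift-sumM (b ∷_) (qsh t v))))

  leftLed-prepend : ∀ a y w → leftLed (prepend a y) w ≋ prepend a (y ·M w)
  leftLed-prepend a y w = begin
    leftLed (prepend a y) w                          ≈⟨ linExt-∘ (leftLedʷ w) (λ t → M (a ∷ t)) y ⟩
    linExt (λ t → linExt (leftLedʷ w) (M (a ∷ t))) y ≈⟨ linExt-ext y (λ t → linExt-M (leftLedʷ w) (a ∷ t)) ⟩
    linExt (λ t → sumM (map (a ∷_) (qsh t w))) y     ≈⟨ linExt-ext y (λ t → lift-sumM (a ∷_) (qsh t w)) ⟨
    linExt (λ t → prepend a (sumM (qsh t w))) y      ≈⟨ linExt-∘ (λ t → M (a ∷ t)) (λ t → sumM (qsh t w)) y ⟨
    prepend a (y ·M w)                               ∎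
    where open SetoidReasoning ≋-setoid

  leftLed-mergeHead : ∀ a y w → leftLed (mergeHead a y) w ≋ mergeLed y a w
  leftLed-mergeHead a y w = ≋-trans (linExt-∘ (leftLedʷ w) (mergeOnto a) y) (linExt-ext y (merged a))
    where
    merged : ∀ a t → linExt (leftLedʷ w) (mergeOnto a t) ≋ mergeLedʷ a w t
    merged a [] = ≋-refl
    merged (ka , ja) ((k , j) ∷ t) with ja FinP.≟ j
    ... | yes refl rewrite dec-true (ja FinP.≟ ja) refl | ℕP.+-comm ka k =
      linExt-M (leftLedʷ w) ((suc (k ℕ.+ ka) , ja) ∷ t)
    ... | no ja≢j rewrite dec-false (j FinP.≟ ja) (λ e → ja≢j (sym e)) = ≋-refl

  leftLed-[] : ∀ x → AllWords NonEmpty x → leftLed x [] ≋ x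
  leftLed-[] x ne = ≋-trans (linExt-ext-on x (All.map single ne)) (linExt-identity x)
    where
    single : ∀ {t} → NonEmpty t → leftLedʷ [] t ≋ M t
    single {a ∷ t} _ = ≡⇒≋ (cong (λ z → sumM (map (a ∷_) z)) (qsh-[]ʳ t))

  -- The explicit antipode

  coarsenings : W → L
  coarsenings [] = M []
  coarsenings (b ∷ r) = prepend b (coarsenings r) ++ mergeHead b (coarsenings r)

  antipodeM : W → L
  antipodeM w = scale (sign (length w)) (coarsenings (reverse w))

  length-snoc : ∀ (p : W) b → length (p ++ b ∷ []) ≡ suc (length p)
  length-snoc p b = trans (LP.length-++ p) (ℕP.+-comm (length p) 1)

  sign-snoc : ∀ (p : W) b → sign (length (p ++ b ∷ [])) ≡ - 1ℤ * sign (length p)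
  sign-snoc p b = cong sign (length-snoc p b)

  coarsenings-snoc : ∀ p b → coarsenings (reverse (p ++ b ∷ [])) ≡
                     prepend b (coarsenings (reverse p)) ++ mergeHead b (coarsenings (reverse p))
  coarsenings-snoc p b = cong coarsenings (LP.reverse-++ p (b ∷ []))

  AllWords-NonEmpty-coarsenings : ∀ r → NonEmpty r → AllWords NonEmpty (coarsenings r)
  AllWords-NonEmpty-coarsenings (b ∷ r) _ =
    AllP.++⁺ (AllWords-linExt (λ t → M (b ∷ t)) {coarsenings r} (λ t → tt ∷ []))
             (AllWords-linExt (mergeOnto b) {coarsenings r} (mergeOnto-NonEmpty b))
    where
    mergeOnto-NonEmpty : ∀ b t → AllWords NonEmpty (mergeOnto b t)
    mergeOnto-NonEmpty b [] = []
    mergeOnto-NonEmpty (k' , j') ((k , j) ∷ t) with does (j' FinP.≟ j)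
    ... | true = tt ∷ []
    ... | false = []

  AllWords-NonEmpty-coarsenings-rev : ∀ p → NonEmpty p → AllWords NonEmpty (coarsenings (reverse p))
  AllWords-NonEmpty-coarsenings-rev (a ∷ p) _ = AllWords-NonEmpty-coarsenings (reverse (a ∷ p))
    (subst NonEmpty (sym (LP.unfold-reverse a p)) (NonEmpty-++ʳ (reverse p) tt))

  leftLed-coarsenings-snoc : ∀ p b v →
    leftLed (coarsenings (reverse (p ++ b ∷ []))) v ≋ rightLed (coarsenings (reverse p)) b v
  leftLed-coarsenings-snoc p b v rewrite coarsenings-snoc p b =
    ≋-trans (≡⇒≋ (linExt-++ (leftLedʷ v) (prepend b X) (mergeHead b X)))
            (++-cong (leftLed-prepend b X v) (leftLed-mergeHead b X v))
    where X = coarsenings (reverse p)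

  Σdeconc : (W → W → L) → W → L
  Σdeconc f v = sumL (map (λ { (β , γ) → f β γ }) (deconc v))

  Σdeconc-cons : ∀ f b v → Σdeconc f (b ∷ v) ≡ f [] (b ∷ v) ++ Σdeconc (λ β γ → f (b ∷ β) γ) v
  Σdeconc-cons f b v = cong (λ z → f [] (b ∷ v) ++ sumL z) (sym (LP.map-∘ (deconc v)))

  Σdeconc-cong : ∀ {f g} v → (∀ β γ → f β γ ≋ g β γ) → Σdeconc f v ≋ Σdeconc g v
  Σdeconc-cong [] e = ++-cong (e [] []) ≋-refl
  Σdeconc-cong {f} {g} (b ∷ v) e = begin
    Σdeconc f (b ∷ v)                                  ≡⟨ Σdeconc-cons f b v ⟩
    f [] (b ∷ v) ++ Σdeconc (λ β γ → f (b ∷ β) γ) v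
      ≈⟨ ++-cong (e [] (b ∷ v)) (Σdeconc-cong v (λ β γ → e (b ∷ β) γ)) ⟩
    g [] (b ∷ v) ++ Σdeconc (λ β γ → g (b ∷ β) γ) v    ≡⟨ Σdeconc-cons g b v ⟨
    Σdeconc g (b ∷ v)                                  ∎
    where open SetoidReasoning ≋-setoid

  Σdeconc-++ᶠ : ∀ f g w → Σdeconc (λ β γ → f β γ ++ g β γ) w ≋ Σdeconc f w ++ Σdeconc g w
  Σdeconc-++ᶠ f g w = sumL-++ᶠ (λ { (β , γ) → f β γ }) (λ { (β , γ) → g β γ }) (deconc w)

  Σdeconc-neg : ∀ f w → Σdeconc (λ β γ → neg (f β γ)) w ≡ neg (Σdeconc f w)
  Σdeconc-neg f w = trans (cong sumL (LP.map-∘ (deconc w))) (sym (neg-sumL (map (λ { (β , γ) → f β γ }) (deconc w))))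
    where
    neg-sumL : ∀ (xs : List L) → neg (sumL xs) ≡ sumL (map neg xs)
    neg-sumL [] = refl
    neg-sumL (x ∷ xs) = trans (scale-++ (- 1ℤ) x (sumL xs)) (cong (neg x ++_) (neg-sumL xs))

  Σdeconc-last : ∀ f w → (∀ β γ → β ++ γ ≡ w → NonEmpty γ → f β γ ≋ []) → Σdeconc f w ≋ f w []
  Σdeconc-last f [] h = ++-identityʳ (f [] [])
  Σdeconc-last f (b ∷ v) h = begin
    Σdeconc f (b ∷ v)                                   ≡⟨ Σdeconc-cons f b v ⟩
    f [] (b ∷ v) ++ Σdeconc (λ β γ → f (b ∷ β) γ) v
      ≈⟨ ++-cong (h [] (b ∷ v) refl tt)
                 (Σdeconc-last (λ β γ → f (b ∷ β) γ) v (λ β γ e ne → h (b ∷ β) γ (cong (b ∷_) e) ne)) ⟩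
    f (b ∷ v) []                                        ∎
    where open SetoidReasoning ≋-setoid

  -- For non-empty p the b-led part of X p ·M (b ∷ γ) cancels the left-led part of X (p ++ [b]) ·M γ,
  -- where X q = coarsenings (reverse q).
  telescope : ∀ (v p : W) → NonEmpty p →
    Σdeconc (λ β γ → antipodeM (p ++ β) ·M γ) v ≋ scale (sign (length p)) (leftLed (coarsenings (reverse p)) v)
  telescope [] p ne rewrite LP.++-identityʳ p = begin
    antipodeM p ·M [] ++ []     ≈⟨ ++-identityʳ _ ⟩
    antipodeM p ·M []           ≈⟨ ·M-identityʳ (antipodeM p) ⟩
    scale s X                   ≈⟨ scale-cong s (leftLed-[] X (AllWords-NonEmpty-coarsenings-rev p ne)) ⟨
    scale s (leftLed X [])      ∎
    where
    open SetoidReasoning ≋-setoid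
    s = sign (length p)
    X = coarsenings (reverse p)
  telescope (b ∷ v) p ne = begin
    Σdeconc f (b ∷ v)
      ≡⟨ Σdeconc-cons f b v ⟩
    f [] (b ∷ v) ++ Σdeconc (λ β γ → f (b ∷ β) γ) v
      ≈⟨ ++-cong first rest ⟩
    scale s (leftLed X (b ∷ v) ++ rightLed X b v) ++ scale (- 1ℤ * s) (rightLed X b v)
      ≈⟨ scale-++-cancelʳ s (leftLed X (b ∷ v)) (rightLed X b v) ⟩
    scale s (leftLed X (b ∷ v)) ∎
    where
    open SetoidReasoning ≋-setoid
    s = sign (length p)
    X = coarsenings (reverse p)
    f : W → W → L
    f β γ = antipodeM (p ++ β) ·M γ
    first : f [] (b ∷ v) ≋ scale s (leftLed X (b ∷ v) ++ rightLed X b v)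
    first = begin
      antipodeM (p ++ []) ·M (b ∷ v)     ≡⟨ cong (λ q → antipodeM q ·M (b ∷ v)) (LP.++-identityʳ p) ⟩
      scale s X ·M (b ∷ v)               ≈⟨ linExt-scale s (λ t → sumM (qsh t (b ∷ v))) X ⟩
      scale s (X ·M (b ∷ v))             ≈⟨ scale-cong s (·M-cons X b v) ⟩
      scale s (leftLed X (b ∷ v) ++ rightLed X b v) ∎
    rest : Σdeconc (λ β γ → f (b ∷ β) γ) v ≋ scale (- 1ℤ * s) (rightLed X b v)
    rest = begin
      Σdeconc (λ β γ → f (b ∷ β) γ) v
        ≈⟨ Σdeconc-cong v (λ β γ → ≡⇒≋ (cong (λ q → antipodeM q ·M γ) (sym (LP.++-assoc p (b ∷ []) β)))) ⟩
      Σdeconc (λ β γ → antipodeM ((p ++ b ∷ []) ++ β) ·M γ) v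
        ≈⟨ telescope v (p ++ b ∷ []) (NonEmpty-++ʳ p tt) ⟩
      scale (sign (length (p ++ b ∷ []))) (leftLed (coarsenings (reverse (p ++ b ∷ []))) v)
        ≈⟨ ≡⇒≋ (cong (λ z → scale z (leftLed (coarsenings (reverse (p ++ b ∷ []))) v)) (sign-snoc p b)) ⟩
      scale (- 1ℤ * s) (leftLed (coarsenings (reverse (p ++ b ∷ []))) v)
        ≈⟨ scale-cong (- 1ℤ * s) (leftLed-coarsenings-snoc p b v) ⟩
      scale (- 1ℤ * s) (rightLed X b v) ∎

  antipodeM-left : ∀ w → Σdeconc (λ β γ → antipodeM β ·M γ) w ≋ ηε w
  antipodeM-left [] = ≋-trans (++-identityʳ _) (≋-trans (·M-identityʳ (antipodeM [])) (scale-identity (M [])))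
  antipodeM-left (b ∷ v) = begin
    Σdeconc (λ β γ → antipodeM β ·M γ) (b ∷ v)
      ≡⟨ Σdeconc-cons (λ β γ → antipodeM β ·M γ) b v ⟩
    antipodeM [] ·M (b ∷ v) ++ Σdeconc (λ β γ → antipodeM (b ∷ β) ·M γ) v
      ≈⟨ ++-cong empty-left (telescope v (b ∷ []) tt) ⟩
    M (b ∷ v) ++ neg (leftLed (coarsenings (b ∷ [])) v)
      ≈⟨ ++-cong {M (b ∷ v)} ≋-refl (scale-cong (- 1ℤ) (leftLed-coarsenings-snoc [] b v)) ⟩
    M (b ∷ v) ++ neg (rightLed (M []) b v)
      ≈⟨ ++-cong {M (b ∷ v)} ≋-refl (scale-cong (- 1ℤ) b-led) ⟩
    M (b ∷ v) ++ neg (M (b ∷ v))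
      ≈⟨ ++-inverseʳ (M (b ∷ v)) ⟩
    [] ∎
    where
    open SetoidReasoning ≋-setoid
    empty-left : antipodeM [] ·M (b ∷ v) ≋ M (b ∷ v)
    empty-left = ≋-trans (linExt-scale 1ℤ (λ t → sumM (qsh t (b ∷ v))) (M []))
                         (≋-trans (scale-identity _) (·M-identityˡ (b ∷ v)))
    b-led : rightLed (M []) b v ≋ M (b ∷ v)
    b-led = ≋-trans (++-cong (≋-trans (lift-cong (b ∷_) (·M-identityˡ v)) (lift-M (b ∷_) v))
                             (linExt-M (mergeLedʷ b v) []))
                    (++-identityʳ (M (b ∷ v)))

  length-<-++ : ∀ (β γ w : W) → β ++ γ ≡ w → NonEmpty γ → suc (length β) ≤ length w
  length-<-++ β (c ∷ γ) w refl _ = begin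
    suc (length β)                 ≤⟨ ℕP.m≤m+n (suc (length β)) (length γ) ⟩
    suc (length β) ℕ.+ length γ    ≡⟨ ℕP.+-suc (length β) (length γ) ⟨
    length β ℕ.+ length (c ∷ γ)    ≡⟨ LP.length-++ β ⟨
    length (β ++ c ∷ γ)            ∎
    where open ℕP.≤-Reasoning

  left-antipode-unique : ∀ (S : W → L) → (∀ w → Σdeconc (λ β γ → S β ·M γ) w ≋ ηε w) →
                         ∀ w → S w ≋ antipodeM w
  left-antipode-unique S S-left w = bounded (length w) w ℕP.≤-refl
    where
    step : ∀ w → (∀ β → suc (length β) ≤ length w → S β ≋ antipodeM β) → S w ≋ antipodeM w
    step w IH = ≋-trans (≋-sym (·M-identityʳ (S w)))
                  (≋-trans (difference≋[]⇒≋ _ _ top≋[]) (·M-identityʳ (antipodeM w)))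
      where
      f : W → W → L
      f β γ = S β ·M γ ++ neg (antipodeM β ·M γ)
      total≋[] : Σdeconc f w ≋ []
      total≋[] = begin
        Σdeconc f w
          ≈⟨ Σdeconc-++ᶠ (λ β γ → S β ·M γ) (λ β γ → neg (antipodeM β ·M γ)) w ⟩
        Σdeconc (λ β γ → S β ·M γ) w ++ Σdeconc (λ β γ → neg (antipodeM β ·M γ)) w
          ≈⟨ ++-cong (S-left w) (≋-trans (≡⇒≋ (Σdeconc-neg (λ β γ → antipodeM β ·M γ) w))
                                         (scale-cong (- 1ℤ) (antipodeM-left w))) ⟩
        ηε w ++ neg (ηε w)
          ≈⟨ ++-inverseʳ (ηε w) ⟩
        [] ∎
        where open SetoidReasoning ≋-setoid
      top≋[] : f w [] ≋ []
      top≋[] = ≋-trans (≋-sym (Σdeconc-last f w lower≋[])) total≋[]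
        where
        lower≋[] : ∀ β γ → β ++ γ ≡ w → NonEmpty γ → f β γ ≋ []
        lower≋[] β γ e ne =
          ≋-trans (++-cong (linExt-cong (λ t → sumM (qsh t γ)) (IH β (length-<-++ β γ w e ne))) ≋-refl)
                  (++-inverseʳ (antipodeM β ·M γ))
    bounded : ∀ n w → length w ≤ n → S w ≋ antipodeM w
    bounded zero [] _ = step [] (λ β ())
    bounded (suc n) w |w|≤1+n = step w (λ β |β|<|w| → bounded n β (ℕP.≤-pred (ℕP.≤-trans |β|<|w| |w|≤1+n)))

  -- Recursions for the fundamental basis

  monochrome : Fin m → List ℕ → W
  monochrome j c = map (λ i → (i , j)) c

  F-cons : ∀ k j δ → F ((k , j) ∷ δ) ≋ sumL (map (λ c → prependWord (monochrome j c) (F δ)) (compsP k))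
  F-cons k j δ = ≋-trans (≡⇒≋ (sumM-concatMap _ (compsP k)))
    (sumL-cong _ _ (compsP k) (λ c → ≋-sym (lift-sumM (monochrome j c ++_) (refinements δ))))

  F-cons-zero : ∀ j δ → F ((0 , j) ∷ δ) ≋ prepend (0 , j) (F δ)
  F-cons-zero j δ = ≋-trans (F-cons 0 j δ) (++-identityʳ _)

  -- compsP (suc k) is built with a helper local to compsP; this exposes it.
  compsP-suc-shape : ∀ k → ∃ λ (inc : List ℕ → List ℕ) → (∀ x xs → inc (x ∷ xs) ≡ suc x ∷ xs) ×
                     compsP (suc k) ≡ map (0 ∷_) (compsP k) ++ map inc (compsP k)
  compsP-suc-shape k = _ , (λ x xs → refl) , refl

  compsP-NonEmpty : ∀ k → All NonEmpty (compsP k)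
  compsP-NonEmpty zero = tt ∷ []
  compsP-NonEmpty (suc k) with compsP-suc-shape k
  ... | inc , inc-cons , shape rewrite shape =
    AllP.++⁺ (AllP.map⁺ (All.universal (λ _ → tt) (compsP k))) (AllP.map⁺ (All.map inc-NonEmpty (compsP-NonEmpty k)))
    where
    inc-NonEmpty : ∀ {c} → NonEmpty c → NonEmpty (inc c)
    inc-NonEmpty {x ∷ xs} _ rewrite inc-cons x xs = tt

  F-cons-suc : ∀ k j δ →
    F ((suc k , j) ∷ δ) ≋ prepend (0 , j) (F ((k , j) ∷ δ)) ++ mergeHead (0 , j) (F ((k , j) ∷ δ))
  F-cons-suc k j δ with compsP-suc-shape k
  ... | inc , inc-cons , shape = begin
    F ((suc k , j) ∷ δ)
      ≈⟨ F-cons (suc k) j δ ⟩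
    sumL (map G (compsP (suc k)))
      ≡⟨ cong (λ cs → sumL (map G cs)) shape ⟩
    sumL (map G (map (0 ∷_) C ++ map inc C))
      ≡⟨ trans (cong sumL (LP.map-++ G (map (0 ∷_) C) (map inc C)))
               (sym (LP.concat-++ (map G (map (0 ∷_) C)) (map G (map inc C)))) ⟩
    sumL (map G (map (0 ∷_) C)) ++ sumL (map G (map inc C))
      ≡⟨ cong₂ (λ a b → sumL a ++ sumL b) (sym (LP.map-∘ C)) (sym (LP.map-∘ C)) ⟩
    sumL (map (λ c → G (0 ∷ c)) C) ++ sumL (map (λ c → G (inc c)) C)
      ≈⟨ ++-cong (sumL-cong _ _ C (λ c → ≋-sym (lift-∘ (c₀ ∷_) (monochrome j c ++_) (F δ))))
                 (sumL-cong-on _ _ (compsP-NonEmpty k) (λ c → merged c)) ⟩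
    sumL (map (λ c → prepend c₀ (G c)) C) ++ sumL (map (λ c → mergeHead c₀ (G c)) C)
      ≡⟨ cong₂ _++_ (linExt-sumL-map (λ t → M (c₀ ∷ t)) G C) (linExt-sumL-map (mergeOnto c₀) G C) ⟨
    prepend c₀ (sumL (map G C)) ++ mergeHead c₀ (sumL (map G C))
      ≈⟨ ++-cong (lift-cong (c₀ ∷_) (F-cons k j δ)) (mergeHead-cong c₀ (F-cons k j δ)) ⟨
    prepend c₀ (F ((k , j) ∷ δ)) ++ mergeHead c₀ (F ((k , j) ∷ δ)) ∎
    where
    open SetoidReasoning ≋-setoid
    c₀ = (0 , j)
    C = compsP k
    G : List ℕ → L
    G c = prependWord (monochrome j c) (F δ)
    merged : ∀ c → NonEmpty c → G (inc c) ≋ mergeHead c₀ (G c)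
    merged (x ∷ xs) _ rewrite inc-cons x xs =
      ≋-sym (≋-trans (linExt-∘ (mergeOnto c₀) (λ t → M (monochrome j (x ∷ xs) ++ t)) (F δ))
        (linExt-ext (F δ) (λ t → ≋-trans (linExt-M (mergeOnto c₀) (monochrome j (x ∷ xs) ++ t))
                                         (≡⇒≋ (mergeOnto-same j 0 x (monochrome j xs ++ t))))))

  growLast : W → W
  growLast [] = []
  growLast ((k , j) ∷ []) = (suc k , j) ∷ []
  growLast (p ∷ q ∷ r) = p ∷ growLast (q ∷ r)

  enlargeLast : L → L
  enlargeLast = lift growLast

  growLast-++ : ∀ (u t : W) → NonEmpty t → growLast (u ++ t) ≡ u ++ growLast t
  growLast-++ [] t _ = refl
  growLast-++ (p ∷ []) (q ∷ r) _ = refl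
  growLast-++ (p ∷ p' ∷ u) (q ∷ r) ne = cong (p ∷_) (growLast-++ (p' ∷ u) (q ∷ r) ne)

  growLast-snoc : ∀ (t₀ : W) k (j : Fin m) → growLast (t₀ ++ (k , j) ∷ []) ≡ t₀ ++ (suc k , j) ∷ []
  growLast-snoc t₀ k j = growLast-++ t₀ ((k , j) ∷ []) tt

  prependWord-append : ∀ u c x → prependWord u (append c x) ≋ append c (prependWord u x)
  prependWord-append u c x = lift-comm-on (u ++_) (_++ c ∷ []) (u ++_) (_++ c ∷ []) x
    (All.universal (λ _ → tt) x) (λ t _ → sym (LP.++-assoc u t (c ∷ [])))

  prependWord-enlargeLast : ∀ u x → AllWords NonEmpty x → prependWord u (enlargeLast x) ≋ enlargeLast (prependWord u x)
  prependWord-enlargeLast u x ne = lift-comm-on (u ++_) growLast (u ++_) growLast x ne (λ t ne-t → sym (growLast-++ u t ne-t))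

  mergeHead-lift-on : ∀ {P : W → Set} b (h : W → W) x → AllWords P x →
    (∀ t → P t → mergeOnto b (h t) ≋ lift h (mergeOnto b t)) → mergeHead b (lift h x) ≋ lift h (mergeHead b x)
  mergeHead-lift-on b h x px comm = begin
    mergeHead b (lift h x)                      ≈⟨ linExt-∘ (mergeOnto b) (λ t → M (h t)) x ⟩
    linExt (λ t → linExt (mergeOnto b) (M (h t))) x
      ≈⟨ linExt-ext-on x (All.map (λ {p} pt → ≋-trans (linExt-M (mergeOnto b) (h (proj₂ p))) (comm (proj₂ p) pt))
                                  px) ⟩
    linExt (λ t → lift h (mergeOnto b t)) x     ≈⟨ linExt-∘ (λ t → M (h t)) (mergeOnto b) x ⟨
    lift h (mergeHead b x)                      ∎
    where open SetoidReasoning ≋-setoid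

  mergeOnto-if : ∀ (h : W → W) (c : Bool) w → (if c then M (h w) else []) ≋ lift h (if c then M w else [])
  mergeOnto-if h true w = ≋-sym (lift-M h w)
  mergeOnto-if h false w = ≋-refl

  mergeHead-append : ∀ b c x → AllWords NonEmpty x → mergeHead b (append c x) ≋ append c (mergeHead b x)
  mergeHead-append b c x ne = mergeHead-lift-on b (_++ c ∷ []) x ne commute
    where
    commute : ∀ t → NonEmpty t → mergeOnto b (t ++ c ∷ []) ≋ append c (mergeOnto b t)
    commute ((x , j') ∷ r) _ =
      mergeOnto-if (_++ c ∷ []) (does (proj₂ b FinP.≟ j')) ((suc (proj₁ b ℕ.+ x) , proj₂ b) ∷ r)

  mergeHead-enlargeLast : ∀ j x → AllWords NonEmpty x →
                          mergeHead (0 , j) (enlargeLast x) ≋ enlargeLast (mergeHead (0 , j) x)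
  mergeHead-enlargeLast j x ne = mergeHead-lift-on (0 , j) growLast x ne commute
    where
    commute : ∀ t → NonEmpty t → mergeOnto (0 , j) (growLast t) ≋ enlargeLast (mergeOnto (0 , j) t)
    commute ((x , j') ∷ []) _ = mergeOnto-if growLast (does (j FinP.≟ j')) ((suc x , j) ∷ [])
    commute ((x , j') ∷ q ∷ r) _ = mergeOnto-if growLast (does (j FinP.≟ j')) ((suc x , j) ∷ q ∷ r)

  EndsIn : Fin m → W → Set
  EndsIn j w = ∃₂ λ t₀ k → w ≡ t₀ ++ (k , j) ∷ []

  StartsIn : Fin m → W → Set
  StartsIn j w = ∃₂ λ k r → w ≡ (k , j) ∷ r

  EndsIn⇒NonEmpty : ∀ {j w} → EndsIn j w → NonEmpty w
  EndsIn⇒NonEmpty (t₀ , k , refl) = NonEmpty-++ʳ t₀ tt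

  EndsIn-++ : ∀ {j} u {w} → EndsIn j w → EndsIn j (u ++ w)
  EndsIn-++ u (t₀ , k , refl) = u ++ t₀ , k , sym (LP.++-assoc u t₀ (_ ∷ []))

  monochrome-EndsIn : ∀ j x xs → EndsIn j (monochrome j (x ∷ xs) ++ [])
  monochrome-EndsIn j x [] = [] , x , refl
  monochrome-EndsIn j x (y ∷ ys) = EndsIn-++ ((x , j) ∷ []) (monochrome-EndsIn j y ys)

  refinements-EndsIn : ∀ (γ : W) k j → All (EndsIn j) (refinements (γ ++ (k , j) ∷ []))
  refinements-EndsIn [] k j = AllP.concat⁺ (AllP.map⁺ (All.map single (compsP-NonEmpty k)))
    where
    single : ∀ {c} → NonEmpty c → All (EndsIn j) (map (λ β → monochrome j c ++ β) ([] ∷ []))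
    single {x ∷ xs} _ = monochrome-EndsIn j x xs ∷ []
  refinements-EndsIn ((k₁ , j₁) ∷ γ) k j =
    AllP.concat⁺ (AllP.map⁺ (All.universal shifted (compsP k₁)))
    where
    shifted : ∀ c → All (EndsIn j) (map (λ β → monochrome j₁ c ++ β) (refinements (γ ++ (k , j) ∷ [])))
    shifted c = AllP.map⁺ (All.map (EndsIn-++ (monochrome j₁ c)) (refinements-EndsIn γ k j))

  refinements-StartsIn : ∀ k j δ → All (StartsIn j) (refinements ((k , j) ∷ δ))
  refinements-StartsIn k j δ = AllP.concat⁺ (AllP.map⁺ (All.map starts (compsP-NonEmpty k)))
    where
    starts : ∀ {c} → NonEmpty c → All (StartsIn j) (map (λ β → monochrome j c ++ β) (refinements δ))
    starts {x ∷ xs} _ = AllP.map⁺ (All.universal (λ β → x , _ , refl) (refinements δ))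

  AllWords-NonEmpty-F-snoc : ∀ (γ : W) k j → AllWords NonEmpty (F (γ ++ (k , j) ∷ []))
  AllWords-NonEmpty-F-snoc γ k j = AllWords-sumM (All.map EndsIn⇒NonEmpty (refinements-EndsIn γ k j))

  F-singleton-zero : ∀ j → F ((0 , j) ∷ []) ≋ M ((0 , j) ∷ [])
  F-singleton-zero j = ≋-trans (F-cons-zero j []) (≋-trans (lift-cong ((0 , j) ∷_) (++-identityʳ (M [])))
                                                            (lift-M ((0 , j) ∷_) []))

  F-snoc-zero : ∀ (γ : W) j → F (γ ++ (0 , j) ∷ []) ≋ append (0 , j) (F γ)
  F-snoc-zero [] j = ≋-trans (F-singleton-zero j)
    (≋-sym (≋-trans (lift-cong (_++ (0 , j) ∷ []) (++-identityʳ (M []))) (lift-M (_++ (0 , j) ∷ []) [])))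
  F-snoc-zero ((k₁ , j₁) ∷ γ) j = begin
    F ((k₁ , j₁) ∷ (γ ++ c ∷ []))
      ≈⟨ F-cons k₁ j₁ (γ ++ c ∷ []) ⟩
    sumL (map (λ c' → prependWord (monochrome j₁ c') (F (γ ++ c ∷ []))) (compsP k₁))
      ≈⟨ sumL-cong _ _ (compsP k₁) (λ c' → ≋-trans (lift-cong (monochrome j₁ c' ++_) (F-snoc-zero γ j))
                                                    (prependWord-append (monochrome j₁ c') c (F γ))) ⟩
    sumL (map (λ c' → append c (prependWord (monochrome j₁ c') (F γ))) (compsP k₁))
      ≡⟨ linExt-sumL-map (λ t → M (t ++ c ∷ [])) (λ c' → prependWord (monochrome j₁ c') (F γ)) (compsP k₁) ⟨
    append c (sumL (map (λ c' → prependWord (monochrome j₁ c') (F γ)) (compsP k₁)))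
      ≈⟨ lift-cong (_++ c ∷ []) (F-cons k₁ j₁ γ) ⟨
    append c (F ((k₁ , j₁) ∷ γ)) ∎
    where
    open SetoidReasoning ≋-setoid
    c = (0 , j)

  lift-F-singleton-zero : ∀ (h : W → W) j → lift h (F ((0 , j) ∷ [])) ≋ M (h ((0 , j) ∷ []))
  lift-F-singleton-zero h j = ≋-trans (lift-cong h (F-singleton-zero j)) (lift-M h _)

  -- The compositions of k + 2 are those of k + 1 followed by a part 1, or with their last part enlarged.
  F-singleton-suc : ∀ k j → F ((suc k , j) ∷ []) ≋ append (0 , j) (F ((k , j) ∷ [])) ++ enlargeLast (F ((k , j) ∷ []))
  F-singleton-suc zero j = begin
    F ((1 , j) ∷ [])
      ≈⟨ F-cons-suc 0 j [] ⟩
    prepend c F₁ ++ mergeHead c F₁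
      ≈⟨ ++-cong (lift-F-singleton-zero (c ∷_) j)
                 (≋-trans (mergeHead-cong c (F-singleton-zero j))
                          (≋-trans (linExt-M (mergeOnto c) (c ∷ [])) (≡⇒≋ (mergeOnto-same j 0 0 [])))) ⟩
    M (c ∷ c ∷ []) ++ M ((1 , j) ∷ [])
      ≈⟨ ++-cong (lift-F-singleton-zero (_++ c ∷ []) j) (lift-F-singleton-zero growLast j) ⟨
    append c F₁ ++ enlargeLast F₁ ∎
    where
    open SetoidReasoning ≋-setoid
    c = (0 , j)
    F₁ = F (c ∷ [])
  F-singleton-suc (suc k) j = begin
    F ((suc (suc k) , j) ∷ [])
      ≈⟨ F-cons-suc (suc k) j [] ⟩
    prepend c Fₖ₊₁ ++ mergeHead c Fₖ₊₁
      ≈⟨ ++-cong (lift-cong (c ∷_) (F-singleton-suc k j)) (mergeHead-cong c (F-singleton-suc k j)) ⟩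
    prepend c (append c Fₖ ++ enlargeLast Fₖ) ++ mergeHead c (append c Fₖ ++ enlargeLast Fₖ)
      ≡⟨ cong₂ _++_ (linExt-++ (λ t → M (c ∷ t)) (append c Fₖ) (enlargeLast Fₖ))
                    (linExt-++ (mergeOnto c) (append c Fₖ) (enlargeLast Fₖ)) ⟩
    (prepend c (append c Fₖ) ++ prepend c (enlargeLast Fₖ)) ++ (mergeHead c (append c Fₖ) ++ mergeHead c (enlargeLast Fₖ))
      ≈⟨ ++-cong (++-cong (prependWord-append (c ∷ []) c Fₖ) (prependWord-enlargeLast (c ∷ []) Fₖ ne))
                 (++-cong (mergeHead-append c c Fₖ ne) (mergeHead-enlargeLast j Fₖ ne)) ⟩
    (append c (prepend c Fₖ) ++ enlargeLast (prepend c Fₖ)) ++ (append c (mergeHead c Fₖ) ++ enlargeLast (mergeHead c Fₖ))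
      ≈⟨ ++-interchange (append c (prepend c Fₖ)) (enlargeLast (prepend c Fₖ)) _ _ ⟩
    (append c (prepend c Fₖ) ++ append c (mergeHead c Fₖ)) ++ (enlargeLast (prepend c Fₖ) ++ enlargeLast (mergeHead c Fₖ))
      ≡⟨ cong₂ _++_ (linExt-++ (λ t → M (t ++ c ∷ [])) (prepend c Fₖ) (mergeHead c Fₖ))
                    (linExt-++ (λ t → M (growLast t)) (prepend c Fₖ) (mergeHead c Fₖ)) ⟨
    append c (prepend c Fₖ ++ mergeHead c Fₖ) ++ enlargeLast (prepend c Fₖ ++ mergeHead c Fₖ)
      ≈⟨ ++-cong (lift-cong (_++ c ∷ []) (F-cons-suc k j [])) (lift-cong growLast (F-cons-suc k j [])) ⟨
    append c Fₖ₊₁ ++ enlargeLast Fₖ₊₁ ∎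
    where
    open SetoidReasoning ≋-setoid
    c = (0 , j)
    Fₖ = F ((k , j) ∷ [])
    Fₖ₊₁ = F ((suc k , j) ∷ [])
    ne : AllWords NonEmpty Fₖ
    ne = AllWords-NonEmpty-F-snoc [] k j

  F-snoc-suc : ∀ (γ : W) k j →
    F (γ ++ (suc k , j) ∷ []) ≋ append (0 , j) (F (γ ++ (k , j) ∷ [])) ++ enlargeLast (F (γ ++ (k , j) ∷ []))
  F-snoc-suc [] k j = F-singleton-suc k j
  F-snoc-suc ((k₁ , j₁) ∷ γ) k j = begin
    F ((k₁ , j₁) ∷ (γ ++ (suc k , j) ∷ []))
      ≈⟨ F-cons k₁ j₁ (γ ++ (suc k , j) ∷ []) ⟩
    sumL (map (λ c' → prependWord (u c') (F (γ ++ (suc k , j) ∷ []))) C)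
      ≈⟨ sumL-cong _ _ C step ⟩
    sumL (map (λ c' → append c (P c') ++ enlargeLast (P c')) C)
      ≈⟨ sumL-++ᶠ (λ c' → append c (P c')) (λ c' → enlargeLast (P c')) C ⟩
    sumL (map (λ c' → append c (P c')) C) ++ sumL (map (λ c' → enlargeLast (P c')) C)
      ≡⟨ cong₂ _++_ (linExt-sumL-map (λ t → M (t ++ c ∷ [])) P C) (linExt-sumL-map (λ t → M (growLast t)) P C) ⟨
    append c (sumL (map P C)) ++ enlargeLast (sumL (map P C))
      ≈⟨ ++-cong (lift-cong (_++ c ∷ []) (F-cons k₁ j₁ (γ ++ (k , j) ∷ [])))
                 (lift-cong growLast (F-cons k₁ j₁ (γ ++ (k , j) ∷ []))) ⟨
    append c (F ((k₁ , j₁) ∷ (γ ++ (k , j) ∷ []))) ++ enlargeLast (F ((k₁ , j₁) ∷ (γ ++ (k , j) ∷ []))) ∎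
    where
    open SetoidReasoning ≋-setoid
    c = (0 , j)
    u = monochrome j₁
    C = compsP k₁
    F' = F (γ ++ (k , j) ∷ [])
    P : List ℕ → L
    P c' = prependWord (u c') F'
    step : ∀ c' → prependWord (u c') (F (γ ++ (suc k , j) ∷ [])) ≋ append c (P c') ++ enlargeLast (P c')
    step c' = begin
      prependWord (u c') (F (γ ++ (suc k , j) ∷ []))
        ≈⟨ lift-cong (u c' ++_) (F-snoc-suc γ k j) ⟩
      prependWord (u c') (append c F' ++ enlargeLast F')
        ≡⟨ linExt-++ (λ t → M (u c' ++ t)) (append c F') (enlargeLast F') ⟩
      prependWord (u c') (append c F') ++ prependWord (u c') (enlargeLast F')
        ≈⟨ ++-cong (prependWord-append (u c') c F') (prependWord-enlargeLast (u c') F' (AllWords-NonEmpty-F-snoc γ k j)) ⟩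
      append c (P c') ++ enlargeLast (P c') ∎

  -- The antipode on the fundamental basis

  neg-linExt-scale : ∀ s (f : W → L) y → scale (- 1ℤ * s) (linExt f y) ≋ neg (linExt f (scale s y))
  neg-linExt-scale s f y =
    ≋-trans (≋-sym (scale-scale (- 1ℤ) s (linExt f y))) (scale-cong (- 1ℤ) (≋-sym (linExt-scale s f y)))

  neg-scale-prepend+mergeHead : ∀ s c y →
    scale (- 1ℤ * s) (prepend c y ++ mergeHead c y) ≋ neg (prepend c (scale s y) ++ mergeHead c (scale s y))
  neg-scale-prepend+mergeHead s c y = begin
    scale (- 1ℤ * s) (prepend c y ++ mergeHead c y)
      ≡⟨ scale-++ (- 1ℤ * s) (prepend c y) (mergeHead c y) ⟩
    scale (- 1ℤ * s) (prepend c y) ++ scale (- 1ℤ * s) (mergeHead c y)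
      ≈⟨ ++-cong (neg-linExt-scale s (λ t → M (c ∷ t)) y) (neg-linExt-scale s (mergeOnto c) y) ⟩
    neg (prepend c (scale s y)) ++ neg (mergeHead c (scale s y))
      ≡⟨ scale-++ (- 1ℤ) (prepend c (scale s y)) (mergeHead c (scale s y)) ⟨
    neg (prepend c (scale s y) ++ mergeHead c (scale s y)) ∎
    where open SetoidReasoning ≋-setoid

  antipodeM-snoc : ∀ (t : W) c → antipodeM (t ++ c ∷ []) ≋ neg (prepend c (antipodeM t) ++ mergeHead c (antipodeM t))
  antipodeM-snoc t c rewrite sign-snoc t c | coarsenings-snoc t c =
    neg-scale-prepend+mergeHead (sign (length t)) c (coarsenings (reverse t))

  mergeHead-prepend : ∀ k (j : Fin m) y → mergeHead (0 , j) (prepend (k , j) y) ≋ prepend (suc k , j) y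
  mergeHead-prepend k j y = ≋-trans (linExt-∘ (mergeOnto (0 , j)) (λ t → M ((k , j) ∷ t)) y)
    (linExt-ext y (λ t → ≋-trans (linExt-M (mergeOnto (0 , j)) ((k , j) ∷ t)) (≡⇒≋ (mergeOnto-same j 0 k t))))

  mergeHead-mergeHead : ∀ k (j : Fin m) y → mergeHead (0 , j) (mergeHead (k , j) y) ≋ mergeHead (suc k , j) y
  mergeHead-mergeHead k j y = ≋-trans (linExt-∘ (mergeOnto (0 , j)) (mergeOnto (k , j)) y) (linExt-ext y twice)
    where
    twice : ∀ t → mergeHead (0 , j) (mergeOnto (k , j) t) ≋ mergeOnto (suc k , j) t
    twice [] = ≋-refl
    twice ((x , j') ∷ r) with j FinP.≟ j'
    ... | yes refl = ≋-trans (linExt-M (mergeOnto (0 , j)) ((suc (k ℕ.+ x) , j) ∷ r))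
                             (≡⇒≋ (mergeOnto-same j 0 (suc (k ℕ.+ x)) r))
    ... | no _ = ≋-refl

  coarsenings-grow : ∀ (t₀ : W) k j →
    coarsenings (reverse (t₀ ++ (suc k , j) ∷ [])) ≋ mergeHead (0 , j) (coarsenings (reverse (t₀ ++ (k , j) ∷ [])))
  coarsenings-grow t₀ k j rewrite coarsenings-snoc t₀ (suc k , j) | coarsenings-snoc t₀ (k , j) =
    ≋-sym (≋-trans (≡⇒≋ (linExt-++ (mergeOnto (0 , j)) (prepend (k , j) X) (mergeHead (k , j) X)))
                   (++-cong (mergeHead-prepend k j X) (mergeHead-mergeHead k j X)))
    where X = coarsenings (reverse t₀)

  antipodeM-grow : ∀ (t₀ : W) k j →
    antipodeM (t₀ ++ (suc k , j) ∷ []) ≋ mergeHead (0 , j) (antipodeM (t₀ ++ (k , j) ∷ []))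
  antipodeM-grow t₀ k j rewrite length-snoc t₀ (suc k , j) | length-snoc t₀ (k , j) =
    ≋-trans (scale-cong (sign (suc (length t₀))) (coarsenings-grow t₀ k j))
            (≋-sym (linExt-scale (sign (suc (length t₀))) (mergeOnto (0 , j)) (coarsenings (reverse (t₀ ++ (k , j) ∷ [])))))

  antipodeF : W → L
  antipodeF α = linExt antipodeM (F α)

  linExt-antipodeM-lift : ∀ (g : W → W) x → linExt antipodeM (lift g x) ≋ linExt (λ t → antipodeM (g t)) x
  linExt-antipodeM-lift g x =
    ≋-trans (linExt-∘ antipodeM (λ t → M (g t)) x) (linExt-ext x (λ t → linExt-M antipodeM (g t)))

  antipodeF-snoc-zero : ∀ (γ : W) j →
    antipodeF (γ ++ (0 , j) ∷ []) ≋ neg (prepend (0 , j) (antipodeF γ) ++ mergeHead (0 , j) (antipodeF γ))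
  antipodeF-snoc-zero γ j = begin
    linExt antipodeM (F (γ ++ c ∷ []))
      ≈⟨ linExt-cong antipodeM (F-snoc-zero γ j) ⟩
    linExt antipodeM (append c (F γ))
      ≈⟨ linExt-antipodeM-lift (_++ c ∷ []) (F γ) ⟩
    linExt (λ t → antipodeM (t ++ c ∷ [])) (F γ)
      ≈⟨ linExt-ext (F γ) (λ t → antipodeM-snoc t c) ⟩
    linExt (λ t → neg (prepend c (antipodeM t) ++ mergeHead c (antipodeM t))) (F γ)
      ≈⟨ linExt-scaleᶠ (- 1ℤ) (λ t → prepend c (antipodeM t) ++ mergeHead c (antipodeM t)) (F γ) ⟩
    neg (linExt (λ t → prepend c (antipodeM t) ++ mergeHead c (antipodeM t)) (F γ))
      ≈⟨ scale-cong (- 1ℤ) (linExt-++ᶠ (λ t → prepend c (antipodeM t)) (λ t → mergeHead c (antipodeM t)) (F γ)) ⟩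
    neg (linExt (λ t → prepend c (antipodeM t)) (F γ) ++ linExt (λ t → mergeHead c (antipodeM t)) (F γ))
      ≈⟨ scale-cong (- 1ℤ) (++-cong (linExt-∘ (λ s → M (c ∷ s)) antipodeM (F γ))
                                    (linExt-∘ (mergeOnto c) antipodeM (F γ))) ⟨
    neg (prepend c (antipodeF γ) ++ mergeHead c (antipodeF γ)) ∎
    where
    open SetoidReasoning ≋-setoid
    c = (0 , j)

  -- For t ending in colour j, the merge term of antipodeM (t ++ [ω^j 1]) cancels antipodeM (growLast t).
  antipodeM-snoc+grow : ∀ j t → EndsIn j t →
    antipodeM (t ++ (0 , j) ∷ []) ++ antipodeM (growLast t) ≋ neg (prepend (0 , j) (antipodeM t))
  antipodeM-snoc+grow j _ (t₀ , k , refl) rewrite growLast-snoc t₀ k j =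
    ≋-trans (++-cong (antipodeM-snoc t (0 , j)) (antipodeM-grow t₀ k j))
            (neg-++-cancelʳ (prepend (0 , j) (antipodeM t)) (mergeHead (0 , j) (antipodeM t)))
    where t = t₀ ++ (k , j) ∷ []

  antipodeF-snoc-suc : ∀ (γ : W) k j →
    antipodeF (γ ++ (suc k , j) ∷ []) ≋ neg (prepend (0 , j) (antipodeF (γ ++ (k , j) ∷ [])))
  antipodeF-snoc-suc γ k j = begin
    linExt antipodeM (F (γ ++ (suc k , j) ∷ []))
      ≈⟨ linExt-cong antipodeM (F-snoc-suc γ k j) ⟩
    linExt antipodeM (append c F' ++ enlargeLast F')
      ≡⟨ linExt-++ antipodeM (append c F') (enlargeLast F') ⟩
    linExt antipodeM (append c F') ++ linExt antipodeM (enlargeLast F')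
      ≈⟨ ++-cong (linExt-antipodeM-lift (_++ c ∷ []) F') (linExt-antipodeM-lift growLast F') ⟩
    linExt (λ t → antipodeM (t ++ c ∷ [])) F' ++ linExt (λ t → antipodeM (growLast t)) F'
      ≈⟨ linExt-++ᶠ (λ t → antipodeM (t ++ c ∷ [])) (λ t → antipodeM (growLast t)) F' ⟨
    linExt (λ t → antipodeM (t ++ c ∷ []) ++ antipodeM (growLast t)) F'
      ≈⟨ linExt-ext-on F' (All.map (antipodeM-snoc+grow j _) (AllWords-sumM (refinements-EndsIn γ k j))) ⟩
    linExt (λ t → neg (prepend c (antipodeM t))) F'
      ≈⟨ linExt-scaleᶠ (- 1ℤ) (λ t → prepend c (antipodeM t)) F' ⟩
    neg (linExt (λ t → prepend c (antipodeM t)) F')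
      ≈⟨ scale-cong (- 1ℤ) (linExt-∘ (λ s → M (c ∷ s)) antipodeM F') ⟨
    neg (prepend c (antipodeF (γ ++ (k , j) ∷ []))) ∎
    where
    open SetoidReasoning ≋-setoid
    c = (0 , j)
    F' = F (γ ++ (k , j) ∷ [])

  -- Conjugation

  stepBetween : Fin m → Fin m → Step
  stepBetween a b = if toℕ a <ᵇ toℕ b then R else D

  firstColour : W → Fin m → Fin m
  firstColour [] j = j
  firstColour ((_ , j') ∷ _) j = j'

  -- the steps of the diagram of γ ++ [(k , j)] up to the first cell of its last part
  stepsBefore : W → Fin m → List Step
  stepsBefore [] j = []
  stepsBefore ((k' , j') ∷ γ) j = replicate k' R ++ (stepBetween j' (firstColour γ j) ∷ stepsBefore γ j)

  stepsOf-snoc : ∀ (γ : W) k j → stepsOf (γ ++ (k , j) ∷ []) ≡ stepsBefore γ j ++ replicate k R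
  stepsOf-snoc [] k j = refl
  stepsOf-snoc ((k' , j') ∷ []) k j = sym (LP.++-assoc (replicate k' R) _ (replicate k R))
  stepsOf-snoc ((k' , j') ∷ (k₂ , j₂) ∷ γ) k j =
    trans (cong (λ z → replicate k' R ++ (stepBetween j' j₂ ∷ z)) (stepsOf-snoc ((k₂ , j₂) ∷ γ) k j))
          (sym (LP.++-assoc (replicate k' R) _ (replicate k R)))

  stepsBefore-snoc : ∀ (γ : W) k' jl j →
    stepsBefore (γ ++ (k' , jl) ∷ []) j ≡ stepsBefore γ jl ++ (replicate k' R ++ (stepBetween jl j ∷ []))
  stepsBefore-snoc [] k' jl j = refl
  stepsBefore-snoc ((k₁ , j₁) ∷ γ) k' jl j =
    trans (cong₂ (λ c z → replicate k₁ R ++ (stepBetween j₁ c ∷ z)) (firstColour-snoc γ) (stepsBefore-snoc γ k' jl j))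
          (sym (LP.++-assoc (replicate k₁ R) _ _))
    where
    firstColour-snoc : ∀ γ → firstColour (γ ++ (k' , jl) ∷ []) j ≡ firstColour γ jl
    firstColour-snoc [] = refl
    firstColour-snoc (_ ∷ _) = refl

  cellsOf-snoc : ∀ (γ : W) k j → cellsOf (γ ++ (k , j) ∷ []) ≡ cellsOf γ ++ replicate (suc k) j
  cellsOf-snoc γ k j = trans (LP.concatMap-++ _ γ ((k , j) ∷ [])) (cong (cellsOf γ ++_) (LP.++-identityʳ _))

  reverse-replicate : ∀ {A : Set} n (a : A) → reverse (replicate n a) ≡ replicate n a
  reverse-replicate zero a = refl
  reverse-replicate (suc n) a = begin
    reverse (a ∷ replicate n a)       ≡⟨ LP.unfold-reverse a (replicate n a) ⟩
    reverse (replicate n a) ++ a ∷ [] ≡⟨ cong (_++ a ∷ []) (reverse-replicate n a) ⟩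
    replicate n a ++ a ∷ []           ≡⟨ replicate-snoc n ⟨
    a ∷ replicate n a                 ∎
    where
    open ≡-Reasoning
    replicate-snoc : ∀ n → replicate (suc n) a ≡ replicate n a ++ a ∷ []
    replicate-snoc zero = refl
    replicate-snoc (suc n) = cong (a ∷_) (replicate-snoc n)

  reflectedCells : W → List (Fin m)
  reflectedCells γ = reverse (cellsOf γ)

  reflectedSteps : W → Fin m → List Step
  reflectedSteps γ j = reverse (map swapStep (stepsBefore γ j))

  readGo-downs : ∀ (j : Fin m) k cs ss →
    readGo j 0 (replicate k j ++ cs) (replicate k D ++ ss) ≡ replicate k (0 , j) ++ readGo j 0 cs ss
  readGo-downs j zero cs ss = refl
  readGo-downs j (suc k) cs ss = cong ((0 , j) ∷_) (readGo-downs j k cs ss)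

  reverse-swapped-rights : ∀ k → reverse (map swapStep (replicate k R)) ≡ replicate k D
  reverse-swapped-rights k = trans (cong reverse (LP.map-replicate swapStep k R)) (reverse-replicate k D)

  -- The last part ω^j (k+1) of α becomes a column, i.e. k+1 parts ω^j 1 starting the conjugate.
  conj-snoc : ∀ (γ : W) k j →
    conj (γ ++ (k , j) ∷ []) ≡ replicate k (0 , j) ++ readGo j 0 (reflectedCells γ) (reflectedSteps γ j)
  conj-snoc γ k j = begin
    conj (γ ++ (k , j) ∷ [])
      ≡⟨ cong₂ (λ a b → readDiagram (reverse a) (reverse (map swapStep b))) (cellsOf-snoc γ k j) (stepsOf-snoc γ k j) ⟩
    readDiagram (reverse (cellsOf γ ++ replicate (suc k) j)) (reverse (map swapStep (stepsBefore γ j ++ replicate k R)))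
      ≡⟨ cong₂ readDiagram cells steps ⟩
    readDiagram (replicate (suc k) j ++ reflectedCells γ) (replicate k D ++ reflectedSteps γ j)
      ≡⟨ readGo-downs j k (reflectedCells γ) (reflectedSteps γ j) ⟩
    replicate k (0 , j) ++ readGo j 0 (reflectedCells γ) (reflectedSteps γ j) ∎
    where
    open ≡-Reasoning
    cells : reverse (cellsOf γ ++ replicate (suc k) j) ≡ replicate (suc k) j ++ reflectedCells γ
    cells = trans (LP.reverse-++ (cellsOf γ) (replicate (suc k) j)) (cong (_++ reflectedCells γ) (reverse-replicate (suc k) j))
    steps : reverse (map swapStep (stepsBefore γ j ++ replicate k R)) ≡ replicate k D ++ reflectedSteps γ j
    steps = trans (cong reverse (LP.map-++ swapStep (stepsBefore γ j) (replicate k R)))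
              (trans (LP.reverse-++ (map swapStep (stepsBefore γ j)) (map swapStep (replicate k R)))
                     (cong (_++ reflectedSteps γ j) (reverse-swapped-rights k)))

  conj-snoc-suc : ∀ (γ : W) k j → conj (γ ++ (suc k , j) ∷ []) ≡ (0 , j) ∷ conj (γ ++ (k , j) ∷ [])
  conj-snoc-suc γ k j = trans (conj-snoc γ (suc k) j) (cong ((0 , j) ∷_) (sym (conj-snoc γ k j)))

  incHead : W → W
  incHead [] = []
  incHead ((k , c) ∷ r) = (suc k , c) ∷ r

  readGo-suc : ∀ (cur : Fin m) k cs ss → readGo cur (suc k) cs ss ≡ incHead (readGo cur k cs ss)
  readGo-suc cur k [] ss = refl
  readGo-suc cur k (c ∷ cs) (R ∷ ss) with does (c FinP.≟ cur)
  ... | true = readGo-suc cur (suc k) cs ss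
  ... | false = refl
  readGo-suc cur k (c ∷ cs) (D ∷ ss) = refl
  readGo-suc cur k (c ∷ cs) [] = refl

  readGo-head : ∀ (cur : Fin m) k cs ss → ∃₂ λ k' r → readGo cur k cs ss ≡ (k' , cur) ∷ r
  readGo-head cur k [] ss = k , [] , refl
  readGo-head cur k (c ∷ cs) (R ∷ ss) with does (c FinP.≟ cur)
  ... | true = readGo-head cur (suc k) cs ss
  ... | false = k , _ , refl
  readGo-head cur k (c ∷ cs) (D ∷ ss) = k , _ , refl
  readGo-head cur k (c ∷ cs) [] = k , _ , refl

  conj-snoc-StartsIn : ∀ (γ : W) k j → StartsIn j (conj (γ ++ (k , j) ∷ []))
  conj-snoc-StartsIn γ zero j with readGo-head j 0 (reflectedCells γ) (reflectedSteps γ j)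
  ... | k' , r , e = k' , r , trans (conj-snoc γ zero j) e
  conj-snoc-StartsIn γ (suc k) j = 0 , _ , conj-snoc-suc γ k j

  conj-snoc-snoc : ∀ (γ : W) k' jl j → conj ((γ ++ (k' , jl) ∷ []) ++ (0 , j) ∷ [])
      ≡ readGo j 0 (jl ∷ (replicate k' jl ++ reflectedCells γ))
                   (swapStep (stepBetween jl j) ∷ (replicate k' D ++ reflectedSteps γ jl))
  conj-snoc-snoc γ k' jl j = trans (conj-snoc (γ ++ (k' , jl) ∷ []) 0 j) (cong₂ (readGo j 0) cells steps)
    where
    cells : reflectedCells (γ ++ (k' , jl) ∷ []) ≡ jl ∷ (replicate k' jl ++ reflectedCells γ)
    cells = trans (cong reverse (cellsOf-snoc γ k' jl))
              (trans (LP.reverse-++ (cellsOf γ) (replicate (suc k') jl))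
                     (cong (_++ reflectedCells γ) (reverse-replicate (suc k') jl)))
    steps : reflectedSteps (γ ++ (k' , jl) ∷ []) j ≡ swapStep (stepBetween jl j) ∷ (replicate k' D ++ reflectedSteps γ jl)
    steps = begin
      reverse (map swapStep (stepsBefore (γ ++ (k' , jl) ∷ []) j))
        ≡⟨ cong (λ z → reverse (map swapStep z)) (stepsBefore-snoc γ k' jl j) ⟩
      reverse (map swapStep (stepsBefore γ jl ++ (replicate k' R ++ (stepBetween jl j ∷ []))))
        ≡⟨ trans (cong reverse (LP.map-++ swapStep (stepsBefore γ jl) _))
                 (LP.reverse-++ (map swapStep (stepsBefore γ jl)) _) ⟩
      reverse (map swapStep (replicate k' R ++ (stepBetween jl j ∷ []))) ++ reflectedSteps γ jl
        ≡⟨ cong (_++ reflectedSteps γ jl) (trans (cong reverse (LP.map-++ swapStep (replicate k' R) (stepBetween jl j ∷ [])))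
             (trans (LP.reverse-++ (map swapStep (replicate k' R)) (swapStep (stepBetween jl j) ∷ []))
                    (cong (swapStep (stepBetween jl j) ∷_) (reverse-swapped-rights k')))) ⟩
      (swapStep (stepBetween jl j) ∷ replicate k' D) ++ reflectedSteps γ jl ∎
      where open ≡-Reasoning

  conj-snoc-readGo : ∀ (γ : W) k' jl →
    conj (γ ++ (k' , jl) ∷ []) ≡ readGo jl 0 (replicate k' jl ++ reflectedCells γ) (replicate k' D ++ reflectedSteps γ jl)
  conj-snoc-readGo γ k' jl = trans (conj-snoc γ k' jl) (sym (readGo-downs jl k' (reflectedCells γ) (reflectedSteps γ jl)))

  n<ᵇn≡false : ∀ n → (n <ᵇ n) ≡ false
  n<ᵇn≡false zero = refl
  n<ᵇn≡false (suc n) = n<ᵇn≡false n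

  -- A new part ω^j 1 after a part of colour j widens the first row of the reflected diagram,
  conj-snoc-same : ∀ (γ : W) k' j → conj ((γ ++ (k' , j) ∷ []) ++ (0 , j) ∷ []) ≡ incHead (conj (γ ++ (k' , j) ∷ []))
  conj-snoc-same γ k' j
    rewrite conj-snoc-snoc γ k' j j | conj-snoc-readGo γ k' j | n<ᵇn≡false (toℕ j) | dec-true (j FinP.≟ j) refl =
    readGo-suc j 0 (replicate k' j ++ reflectedCells γ) (replicate k' D ++ reflectedSteps γ j)

  -- while after a part of another colour it is a new row.
  conj-snoc-other : ∀ (γ : W) k' jl j → ¬ jl ≡ j →
    conj ((γ ++ (k' , jl) ∷ []) ++ (0 , j) ∷ []) ≡ (0 , j) ∷ conj (γ ++ (k' , jl) ∷ [])
  conj-snoc-other γ k' jl j jl≢j rewrite conj-snoc-snoc γ k' jl j | conj-snoc-readGo γ k' jl with toℕ jl <ᵇ toℕ j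
  ... | true = refl
  ... | false rewrite dec-false (jl FinP.≟ j) jl≢j = refl

  signedConjF : W → L
  signedConjF γ = scale (sign (size γ)) (F (conj γ))

  size-++ : ∀ (γ δ : W) → size (γ ++ δ) ≡ size γ ℕ.+ size δ
  size-++ [] δ = refl
  size-++ (p ∷ γ) δ = trans (cong (partSize p ℕ.+_) (size-++ γ δ)) (sym (ℕP.+-assoc (partSize p) (size γ) (size δ)))

  size-snoc : ∀ (γ : W) k j → size (γ ++ (k , j) ∷ []) ≡ size γ ℕ.+ suc k
  size-snoc γ k j = trans (size-++ γ _) (cong (size γ ℕ.+_) (ℕP.+-identityʳ (suc k)))

  size-snoc-suc : ∀ (γ : W) k j → size (γ ++ (suc k , j) ∷ []) ≡ suc (size (γ ++ (k , j) ∷ []))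
  size-snoc-suc γ k j = trans (size-snoc γ (suc k) j) (trans (ℕP.+-suc (size γ) (suc k)) (cong suc (sym (size-snoc γ k j))))

  size-snoc-zero : ∀ (γ : W) j → size (γ ++ (0 , j) ∷ []) ≡ suc (size γ)
  size-snoc-zero γ j = trans (size-snoc γ 0 j) (ℕP.+-comm (size γ) 1)

  signedConjF-snoc-suc : ∀ (γ : W) k j →
    signedConjF (γ ++ (suc k , j) ∷ []) ≋ neg (prepend (0 , j) (signedConjF (γ ++ (k , j) ∷ [])))
  signedConjF-snoc-suc γ k j rewrite size-snoc-suc γ k j | conj-snoc-suc γ k j =
    ≋-trans (scale-cong (sign (suc (size (γ ++ (k , j) ∷ [])))) (F-cons-zero j (conj (γ ++ (k , j) ∷ []))))
            (neg-linExt-scale (sign (size (γ ++ (k , j) ∷ []))) (λ s → M ((0 , j) ∷ s)) (F (conj (γ ++ (k , j) ∷ []))))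

  mergeHead-StartsIn-other : ∀ {i} j → ¬ i ≡ j → ∀ x → AllWords (StartsIn i) x → mergeHead (0 , j) x ≋ []
  mergeHead-StartsIn-other {i} j i≢j x starts = ≋-trans (linExt-ext-on x (All.map vanish starts)) (linExt-zero x)
    where
    vanish : ∀ {t} → StartsIn i t → mergeOnto (0 , j) t ≋ []
    vanish (x , r , refl) = ≡⇒≋ (mergeOnto-other 0 x r (λ e → i≢j (sym e)))

  signedConjF-snoc-zero : ∀ {γ : W} → Reverse γ → ∀ j →
    signedConjF (γ ++ (0 , j) ∷ []) ≋ neg (prepend (0 , j) (signedConjF γ) ++ mergeHead (0 , j) (signedConjF γ))
  signedConjF-snoc-zero [] j = begin
    scale (- 1ℤ * 1ℤ) (F (c ∷ []))
      ≈⟨ scale-cong (- 1ℤ * 1ℤ) (F-singleton-zero j) ⟩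
    scale (- 1ℤ * 1ℤ) (M (c ∷ []))
      ≈⟨ scale-cong (- 1ℤ) (++-cong (lift-M (c ∷_) []) (linExt-M (mergeOnto c) [])) ⟨
    neg (prepend c (M []) ++ mergeHead c (M []))
      ≈⟨ scale-cong (- 1ℤ) (++-cong (lift-cong (c ∷_) signedConjF[]) (mergeHead-cong c signedConjF[])) ⟨
    neg (prepend c (signedConjF []) ++ mergeHead c (signedConjF [])) ∎
    where
    open SetoidReasoning ≋-setoid
    c = (0 , j)
    signedConjF[] : signedConjF [] ≋ M []
    signedConjF[] = ≋-trans (scale-identity (F [])) (++-identityʳ (M []))
  signedConjF-snoc-zero (γ ∶ _ ∶ʳ (k' , jl)) j with conj-snoc-StartsIn γ k' jl | jl FinP.≟ j
  ... | k'' , r , conj≡ | yes refl rewrite size-snoc-zero (γ ++ (k' , jl) ∷ []) jl | conj-snoc-same γ k' jl | conj≡ =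
    ≋-trans (scale-cong (sign (suc (size (γ ++ (k' , jl) ∷ [])))) (F-cons-suc k'' jl r))
            (neg-scale-prepend+mergeHead (sign (size (γ ++ (k' , jl) ∷ []))) (0 , jl) (F ((k'' , jl) ∷ r)))
  ... | k'' , r , conj≡ | no jl≢j
    rewrite size-snoc-zero (γ ++ (k' , jl) ∷ []) j | conj-snoc-other γ k' jl j jl≢j | conj≡ =
    ≋-trans (scale-cong (sign (suc (size (γ ++ (k' , jl) ∷ []))))
                        (≋-trans (F-cons-zero j ((k'' , jl) ∷ r)) (≋-sym no-merge)))
            (neg-scale-prepend+mergeHead (sign (size (γ ++ (k' , jl) ∷ []))) (0 , j) (F ((k'' , jl) ∷ r)))
    where
    no-merge : prepend (0 , j) (F ((k'' , jl) ∷ r)) ++ mergeHead (0 , j) (F ((k'' , jl) ∷ r))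
               ≋ prepend (0 , j) (F ((k'' , jl) ∷ r))
    no-merge = ≋-trans (++-cong ≋-refl (mergeHead-StartsIn-other j jl≢j _ (AllWords-sumM (refinements-StartsIn k'' jl r))))
                       (++-identityʳ _)

  antipodeF≋signedConjF : ∀ α → antipodeF α ≋ signedConjF α
  antipodeF≋signedConjF α = along (reverseView α)
    where
    along : ∀ {α} → Reverse α → antipodeF α ≋ signedConjF α
    lastPart : ∀ {γ} → Reverse γ → ∀ k j → antipodeF (γ ++ (k , j) ∷ []) ≋ signedConjF (γ ++ (k , j) ∷ [])
    along [] = ≋-trans (linExt-cong antipodeM (++-identityʳ (M [])))
                       (≋-trans (linExt-M antipodeM []) (≋-sym (scale-identity (F []))))
    along (γ ∶ rγ ∶ʳ (k , j)) = lastPart rγ k j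
    lastPart {γ} rγ zero j = begin
      antipodeF (γ ++ (0 , j) ∷ [])
        ≈⟨ antipodeF-snoc-zero γ j ⟩
      neg (prepend (0 , j) (antipodeF γ) ++ mergeHead (0 , j) (antipodeF γ))
        ≈⟨ scale-cong (- 1ℤ) (++-cong (lift-cong ((0 , j) ∷_) (along rγ)) (mergeHead-cong (0 , j) (along rγ))) ⟩
      neg (prepend (0 , j) (signedConjF γ) ++ mergeHead (0 , j) (signedConjF γ))
        ≈⟨ signedConjF-snoc-zero rγ j ⟨
      signedConjF (γ ++ (0 , j) ∷ []) ∎
      where open SetoidReasoning ≋-setoid
    lastPart {γ} rγ (suc k) j = begin
      antipodeF (γ ++ (suc k , j) ∷ [])
        ≈⟨ antipodeF-snoc-suc γ k j ⟩
      neg (prepend (0 , j) (antipodeF (γ ++ (k , j) ∷ [])))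
        ≈⟨ scale-cong (- 1ℤ) (lift-cong ((0 , j) ∷_) (lastPart rγ k j)) ⟩
      neg (prepend (0 , j) (signedConjF (γ ++ (k , j) ∷ [])))
        ≈⟨ signedConjF-snoc-suc γ k j ⟨
      signedConjF (γ ++ (suc k , j) ∷ []) ∎
      where open SetoidReasoning ≋-setoid

mainTheorem11 : (m : ℕ) → 1 ≤ m →
    (S : Comp m → Lin m) → IsAntipode S →
    (α : Comp m) →
    linExt S (F α) ≈ scale (sign (size α)) (F (conj α))
mainTheorem11 m _ S (S-left , _) α = get (begin
  linExt S (F α)              ≈⟨ linExt-ext (F α) S≋antipodeM ⟩
  antipodeF α                 ≈⟨ antipodeF≋signedConjF α ⟩
  signedConjF α               ∎)
  where
  open SetoidReasoning ≋-setoid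
  S≋antipodeM : ∀ w → S w ≋ antipodeM w
  S≋antipodeM = left-antipode-unique S λ w →
    ≋-trans (Σdeconc-cong w (λ β γ → ≡⇒≋ (sym (mul-M (S β) γ)))) (mk≋ (S-left w))
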